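{- No two nonisomorphic threshold graphs are cospectral; that is, if two threshold graphs have the same adjacency spectrum (eigenvalues of their adjacency matrices, counted with multiplicity), then they are isomorphic.
   Context: All graphs are finite, simple and undirected. A threshold graph is a graph obtained from a single vertex by repeatedly adding either an isolated vertex or a dominating vertex (one adjacent to all previously present vertices). Two nonisomorphic graphs are cospectral if their adjacency matrices have the same spectrum. -}

module Defs where

open import Data.Nat using (ℕ; zero; suc)
open import Data.Integer using (ℤ; _+_; _*_; -_) renaming (+_ to ⁺_)
open import Data.Fin using (Fin; zero; suc; punchIn; _≟_)
open import Data.Bool using (Bool; true; false; if_then_else_)
open import Data.List using (List; []; _∷_; map; length)
open import Relation.Nullary using (does)
open import Relation.Binary.PropositionalEquality using (_≡_; refl)
open import Data.Product using (Σ; ∃; _×_; _,_)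
open import Function.Bundles using (_↔_; Inverse)

record Graph : Set where
  field
    order  : ℕ
    adj    : Fin order → Fin order → Bool
    irrefl : ∀ i → adj i i ≡ false
    sym    : ∀ i j → adj i j ≡ adj j i
open Graph public

_≅_ : Graph → Graph → Set
G ≅ H = Σ (Fin (order G) ↔ Fin (order H)) λ f →
          ∀ i j → adj G i j ≡ adj H (Inverse.to f i) (Inverse.to f j)

K₁ : Graph
K₁ = record { order = 1 ; adj = λ _ _ → false ; irrefl = λ _ → refl ; sym = λ _ _ → refl }

-- add a new vertex (index zero); b = true: dominating, b = false: isolated
addVertex : Bool → Graph → Graph
addVertex b G = record { order = suc (order G) ; adj = a ; irrefl = ir ; sym = sy }
  where
  a : Fin (suc (order G)) → Fin (suc (order G)) → Bool
  a zero    zero    = false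
  a zero    (suc j) = b
  a (suc i) zero    = b
  a (suc i) (suc j) = adj G i j
  ir : ∀ i → a i i ≡ false
  ir zero = refl
  ir (suc i) = irrefl G i
  sy : ∀ i j → a i j ≡ a j i
  sy zero zero = refl
  sy zero (suc j) = refl
  sy (suc i) zero = refl
  sy (suc i) (suc j) = sym G i j

-- build s: start from a single vertex, apply the steps of s
-- (the head of s is the LAST vertex added)
build : List Bool → Graph
build []      = K₁
build (b ∷ s) = addVertex b (build s)

IsThreshold : Graph → Set
IsThreshold G = ∃ λ s → G ≅ build s

-- Integer polynomials as coefficient lists (lowest degree first)

Poly : Set
Poly = List ℤ

infixl 6 _+P_ _-P_
infixl 7 _*P_

_+P_ : Poly → Poly → Poly
[]      +P q       = q
(a ∷ p) +P []      = a ∷ p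
(a ∷ p) +P (b ∷ q) = (a + b) ∷ (p +P q)

negP : Poly → Poly
negP = map -_

_-P_ : Poly → Poly → Poly
p -P q = p +P negP q

_·P_ : ℤ → Poly → Poly
c ·P p = map (c *_) p

_*P_ : Poly → Poly → Poly
[]      *P q = []
(a ∷ p) *P q = (a ·P q) +P ((⁺ 0) ∷ (p *P q))

coeff : Poly → ℕ → ℤ
coeff []      _       = ⁺ 0
coeff (a ∷ p) zero    = a
coeff (a ∷ p) (suc k) = coeff p k

constP : ℤ → Poly
constP c = c ∷ []

X : Poly
X = ⁺ 0 ∷ ⁺ 1 ∷ []

altSum : ∀ {n} → (Fin n → Poly) → Poly
altSum {zero}  f = []
altSum {suc n} f = f zero -P altSum {n} (λ j → f (suc j))

det : ∀ n → (Fin n → Fin n → Poly) → Poly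
det zero    M = constP (⁺ 1)
det (suc n) M = altSum (λ j → M zero j *P det n (λ i k → M (suc i) (punchIn j k)))

boolℤ : Bool → ℤ
boolℤ true  = ⁺ 1
boolℤ false = ⁺ 0

adjMatrix : (G : Graph) → Fin (order G) → Fin (order G) → ℤ
adjMatrix G i j = boolℤ (adj G i j)

charPoly : Graph → Poly
charPoly G = det (order G) (λ i j →
  (if does (i ≟ j) then X else []) -P constP (adjMatrix G i j))

-- Same adjacency spectrum (eigenvalues with multiplicity) ⇔ equal
-- characteristic polynomials (coefficientwise).
SameSpectrum : Graph → Graph → Set
SameSpectrum G H = ∀ k → coeff (charPoly G) k ≡ coeff (charPoly H) k

{-# OPTIONS --safe #-}
module Submission where

-- Adding a vertex, dominating (b = 1) or isolated (b = 0), borders xI - A by the row and column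
-- (x, -b, ..., -b). Expanding along them, the pair p = det (xI - A), r = p + 1ᵀ adj (xI - A) 1
-- evolves linearly: T₀ (p , r) = (x p , x r + p) and T₁ (p , r) = ((x+1) p - r , (x+1) r), starting
-- from (x , x+1) = T_b (1 , 1). So the characteristic polynomial of the graph built from s₁ ... sₙ
-- is the pairing of (1 , 1) with the covector e₁ T_{s₁} ... T_{sₙ} T_β, for any β.
-- These covectors have the shape x^a (x+1)^c (A(y) , x B(y)) or x^a (x+1)^c ((x+1) A(y) , B(y)),
-- with y = x(x+1), and sign and ratio constraints on A(0), B(0). Taking for β the current shape,
-- a and c are the multiplicities of the roots 0 and -1; the remaining factor U(y) + x V(y)
-- determines U and V, since x ↦ -1 - x fixes y; these determine the shape, A and B; and each T_b
-- acts injectively and is read off from the shape. Hence the characteristic polynomial determines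
-- the sequence s, and thus the graph. Polynomials are compared through their values on ℤ.

open import Defs hiding (sym)
open import Data.Nat as ℕ using (ℕ; zero; suc)
import Data.Nat.Properties as ℕ
open import Data.Integer as ℤ using (ℤ; +_; +[1+_]; 0ℤ; 1ℤ; -1ℤ; _+_; _*_; -_; _-_; ∣_∣; _^_)
import Data.Integer.Properties as ℤ
open import Data.Integer.Tactic.RingSolver using (solve-∀)
open import Algebra.Properties.AbelianGroup ℤ.+-0-abelianGroup
  using (inverseʳ-unique) renaming (∙-cancelˡ to +-cancelˡ; ∙-cancelʳ to +-cancelʳ)
open import Data.Bool using (Bool; true; false; if_then_else_)
open import Data.Fin using (Fin; zero; suc; punchIn; pinch; _≟_)
open import Data.Fin.Permutation as Perm
  using ( Permutation; Permutation′; _⟨$⟩ʳ_; _⟨$⟩ˡ_; _∘ₚ_; lift₀; remove; permutation; inverseʳ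
        ; lift₀-remove; ↔⇒≡)
open import Data.List using (List; []; _∷_; map; _++_; foldl; foldr; reverse)
import Data.List.Properties as List
open import Data.Product using (Σ; _×_; _,_; proj₁; proj₂)
open import Data.Sum using (_⊎_; inj₁; inj₂)
open import Data.Empty using (⊥; ⊥-elim)
open import Function using (_∘_; id; flip)
open import Function.Bundles using (Injection; mk⇔)
open import Function.Properties.Inverse using (↔⇒↣)
open import Relation.Nullary using (¬_; does; contradiction)
open import Relation.Nullary.Decidable using (does-⇔)
open import Relation.Binary.Definitions using (tri<; tri≈; tri>)
open import Relation.Binary.PropositionalEquality
  using (_≡_; _≢_; _≗_; refl; sym; trans; cong; cong₂; subst; subst₂; module ≡-Reasoning)

open ≡-Reasoning

-- Polynomials as functions on ℤ

eval : Poly → ℤ → ℤ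
eval []      x = 0ℤ
eval (a ∷ p) x = a + x * eval p x

eval-+P : ∀ p q x → eval (p +P q) x ≡ eval p x + eval q x
eval-+P []      q       x = sym (ℤ.+-identityˡ _)
eval-+P (a ∷ p) []      x = sym (ℤ.+-identityʳ _)
eval-+P (a ∷ p) (b ∷ q) x rewrite eval-+P p q x = shuffle a b x (eval p x) (eval q x)
  where
  shuffle : ∀ a b x u v → a + b + x * (u + v) ≡ a + x * u + (b + x * v)
  shuffle = solve-∀

eval-negP : ∀ p x → eval (negP p) x ≡ - eval p x
eval-negP []      x = refl
eval-negP (a ∷ p) x rewrite eval-negP p x = neg-distrib a x (eval p x)
  where
  neg-distrib : ∀ a x u → - a + x * - u ≡ - (a + x * u)
  neg-distrib = solve-∀

eval--P : ∀ p q x → eval (p -P q) x ≡ eval p x - eval q x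
eval--P p q x rewrite eval-+P p (negP q) x | eval-negP q x = refl

eval-·P : ∀ c p x → eval (c ·P p) x ≡ c * eval p x
eval-·P c []      x = sym (ℤ.*-zeroʳ c)
eval-·P c (a ∷ p) x rewrite eval-·P c p x = distrib c a x (eval p x)
  where
  distrib : ∀ c a x u → c * a + x * (c * u) ≡ c * (a + x * u)
  distrib = solve-∀

eval-*P : ∀ p q x → eval (p *P q) x ≡ eval p x * eval q x
eval-*P []      q x = refl
eval-*P (a ∷ p) q x
  rewrite eval-+P (a ·P q) (0ℤ ∷ (p *P q)) x | eval-·P a q x | eval-*P p q x
  = distrib a x (eval p x) (eval q x)
  where
  distrib : ∀ a x u v → a * v + (0ℤ + x * (u * v)) ≡ (a + x * u) * v
  distrib = solve-∀

eval-constP : ∀ c x → eval (constP c) x ≡ c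
eval-constP c x rewrite ℤ.*-zeroʳ x = ℤ.+-identityʳ c

eval-X : ∀ x → eval X x ≡ x
eval-X = horner
  where
  horner : ∀ x → 0ℤ + x * (1ℤ + x * 0ℤ) ≡ x
  horner = solve-∀

eval-X*P : ∀ p x → eval (X *P p) x ≡ x * eval p x
eval-X*P p x rewrite eval-*P X p x | eval-X x = refl

eval-coeff-zero : ∀ p → (∀ k → coeff p k ≡ 0ℤ) → ∀ x → eval p x ≡ 0ℤ
eval-coeff-zero []      _     x = refl
eval-coeff-zero (a ∷ p) coeff≡0 x
  rewrite coeff≡0 zero | eval-coeff-zero p (coeff≡0 ∘ suc) x = cong (λ z → 0ℤ + z) (ℤ.*-zeroʳ x)

eval-cong-coeff : ∀ p q → (∀ k → coeff p k ≡ coeff q k) → ∀ x → eval p x ≡ eval q x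
eval-cong-coeff []      q       p≡q x = sym (eval-coeff-zero q (sym ∘ p≡q) x)
eval-cong-coeff (a ∷ p) []      p≡q x = eval-coeff-zero (a ∷ p) p≡q x
eval-cong-coeff (a ∷ p) (b ∷ q) p≡q x
  rewrite p≡q zero | eval-cong-coeff p q (p≡q ∘ suc) x = refl

_∘P_ : Poly → Poly → Poly
[]      ∘P q = []
(a ∷ p) ∘P q = constP a +P (q *P (p ∘P q))

eval-∘P : ∀ p q x → eval (p ∘P q) x ≡ eval p (eval q x)
eval-∘P []      q x = refl
eval-∘P (a ∷ p) q x
  rewrite eval-+P (constP a) (q *P (p ∘P q)) x | eval-constP a x
        | eval-*P q (p ∘P q) x | eval-∘P p q x = refl

IsPolynomial : (ℤ → ℤ) → Set
IsPolynomial f = Σ Poly λ p → f ≗ eval p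

eval-isPolynomial : ∀ p → IsPolynomial (eval p)
eval-isPolynomial p = p , λ _ → refl

const-isPolynomial : ∀ c → IsPolynomial (λ _ → c)
const-isPolynomial c = constP c , λ x → sym (eval-constP c x)

id-isPolynomial : IsPolynomial (λ x → x)
id-isPolynomial = X , λ x → sym (eval-X x)

+-isPolynomial : ∀ {f g} → IsPolynomial f → IsPolynomial g → IsPolynomial (λ x → f x + g x)
+-isPolynomial (p , f≗p) (q , g≗q) =
  p +P q , λ x → trans (cong₂ _+_ (f≗p x) (g≗q x)) (sym (eval-+P p q x))

minus-isPolynomial : ∀ {f g} → IsPolynomial f → IsPolynomial g → IsPolynomial (λ x → f x - g x)
minus-isPolynomial (p , f≗p) (q , g≗q) =
  p -P q , λ x → trans (cong₂ _-_ (f≗p x) (g≗q x)) (sym (eval--P p q x))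

*-isPolynomial : ∀ {f g} → IsPolynomial f → IsPolynomial g → IsPolynomial (λ x → f x * g x)
*-isPolynomial (p , f≗p) (q , g≗q) =
  p *P q , λ x → trans (cong₂ _*_ (f≗p x) (g≗q x)) (sym (eval-*P p q x))

^-isPolynomial : ∀ {f} → IsPolynomial f → ∀ e → IsPolynomial (λ x → f x ^ e)
^-isPolynomial pf zero    = const-isPolynomial 1ℤ
^-isPolynomial pf (suc e) = *-isPolynomial pf (^-isPolynomial pf e)

∘-isPolynomial : ∀ {f g} → IsPolynomial f → IsPolynomial g → IsPolynomial (f ∘ g)
∘-isPolynomial {f} {g} (p , f≗p) (q , g≗q) =
  p ∘P q , λ x → trans (f≗p (g x)) (trans (cong (eval p) (g≗q x)) (sym (eval-∘P p q x)))

≗-isPolynomial : ∀ {f g} → f ≗ g → IsPolynomial g → IsPolynomial f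
≗-isPolynomial f≗g (p , g≗p) = p , λ x → trans (f≗g x) (g≗p x)

Unbounded : (ℕ → ℤ) → Set
Unbounded g = ∀ n → n ℕ.< ∣ g n ∣

unbounded-≢0 : ∀ {g} → Unbounded g → ∀ n → g n ≢ 0ℤ
unbounded-≢0 big n g≡0 = ℕ.n≮0 (subst (λ z → n ℕ.< ∣ z ∣) g≡0 (big n))

-- |a| = |t| |e| is below |t| only when e = 0.
small-multiple-zero : ∀ a t e → a + t * e ≡ 0ℤ → ∣ a ∣ ℕ.< ∣ t ∣ → a ≡ 0ℤ
small-multiple-zero a t e a+te≡0 small = ℤ.∣i∣≡0⇒i≡0 (by-cases ∣ e ∣ ∣a∣≡∣t∣∣e∣)
  where
  ∣a∣≡∣t∣∣e∣ : ∣ a ∣ ≡ ∣ t ∣ ℕ.* ∣ e ∣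
  ∣a∣≡∣t∣∣e∣ = begin
    ∣ a ∣           ≡⟨ cong ∣_∣ (ℤ.i-j≡0⇒i≡j a (- (t * e))
                                   (trans (cong (λ z → a + z) (ℤ.neg-involutive _)) a+te≡0)) ⟩
    ∣ - (t * e) ∣   ≡⟨ ℤ.∣-i∣≡∣i∣ (t * e) ⟩
    ∣ t * e ∣       ≡⟨ ℤ.abs-* t e ⟩
    ∣ t ∣ ℕ.* ∣ e ∣ ∎
  by-cases : ∀ m → ∣ a ∣ ≡ ∣ t ∣ ℕ.* m → ∣ a ∣ ≡ 0
  by-cases zero    eq = trans eq (ℕ.*-zeroʳ ∣ t ∣)
  by-cases (suc m) eq = contradiction (subst (∣ t ∣ ℕ.≤_) (sym eq) (ℕ.m≤m*n ∣ t ∣ (suc m))) (ℕ.<⇒≱ small)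

eval-zero-on-unbounded : ∀ p {g} → Unbounded g → (∀ n → eval p (g n) ≡ 0ℤ) → ∀ x → eval p x ≡ 0ℤ
eval-zero-on-unbounded []      big vanish x = refl
eval-zero-on-unbounded (a ∷ p) {g} big vanish x = begin
  a + x * eval p x   ≡⟨ cong₂ (λ u v → u + x * v) a≡0 (eval-zero-on-unbounded p big tail-vanish x) ⟩
  0ℤ + x * 0ℤ        ≡⟨ cong (λ z → 0ℤ + z) (ℤ.*-zeroʳ x) ⟩
  0ℤ                 ∎
  where
  a≡0 : a ≡ 0ℤ
  a≡0 = small-multiple-zero a (g ∣ a ∣) _ (vanish ∣ a ∣) (big ∣ a ∣)
  tail-vanish : ∀ n → eval p (g n) ≡ 0ℤ
  tail-vanish n with ℤ.i*j≡0⇒i≡0∨j≡0 (g n) (trans (sym (ℤ.+-identityˡ _))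
                                                    (subst (λ c → c + g n * eval p (g n) ≡ 0ℤ) a≡0 (vanish n)))
  ... | inj₁ g≡0 = contradiction g≡0 (unbounded-≢0 {g} big n)
  ... | inj₂ e≡0 = e≡0

polynomial-agree : ∀ {f h g} → IsPolynomial f → IsPolynomial h → Unbounded g →
                   (∀ n → f (g n) ≡ h (g n)) → f ≗ h
polynomial-agree {f} {h} {g} pf ph big agree x = ℤ.i-j≡0⇒i≡j (f x) (h x) (difference≡0 x)
  where
  difference≡0 : ∀ x → f x - h x ≡ 0ℤ
  difference≡0 x with minus-isPolynomial pf ph
  ... | (p , d≗p) = trans (d≗p x) (eval-zero-on-unbounded p big
                      (λ n → trans (sym (d≗p (g n))) (ℤ.i≡j⇒i-j≡0 (agree n))) x)

awayFrom : ℤ → ℕ → ℤ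
awayFrom c n = +[1+ n ℕ.+ ∣ c ∣ ]

awayFrom-unbounded : ∀ c → Unbounded (awayFrom c)
awayFrom-unbounded c n = ℕ.s≤s (ℕ.m≤m+n n ∣ c ∣)

awayFrom-≢ : ∀ c n → awayFrom c n - c ≢ 0ℤ
awayFrom-≢ c n eq = ℕ.m≢1+n+m ∣ c ∣ (sym (cong ∣_∣ (ℤ.i-j≡0⇒i≡j (awayFrom c n) c eq)))

power-cancel : ∀ c e {F G} → IsPolynomial F → IsPolynomial G →
               (∀ x → (x - c) ^ e * F x ≡ (x - c) ^ e * G x) → F ≗ G
power-cancel c e pF pG eq = polynomial-agree {g = awayFrom c} pF pG (awayFrom-unbounded c) λ n →
  let x = awayFrom c n in
  ℤ.*-cancelˡ-≡ ((x - c) ^ e) _ _ {{ℤ.≢-nonZero (awayFrom-≢ c n ∘ ℤ.i^n≡0⇒i≡0 (x - c) e)}} (eq x)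

root-of-higher-power : ∀ c e k {F G} → IsPolynomial F → IsPolynomial G →
                       (∀ x → (x - c) ^ e * F x ≡ (x - c) ^ (suc e ℕ.+ k) * G x) → F c ≡ 0ℤ
root-of-higher-power c e k {F} {G} pF pG eq = begin
  F c                    ≡⟨ power-cancel c e pF pH eq′ c ⟩
  (c - c) ^ suc k * G c  ≡⟨ cong (λ z → z ^ suc k * G c) (ℤ.+-inverseʳ c) ⟩
  0ℤ * G c               ≡⟨ ℤ.*-zeroˡ (G c) ⟩
  0ℤ                     ∎
  where
  H : ℤ → ℤ
  H x = (x - c) ^ suc k * G x
  pH : IsPolynomial H
  pH = *-isPolynomial (^-isPolynomial (minus-isPolynomial id-isPolynomial (const-isPolynomial c)) (suc k)) pG
  regroup : ∀ y a b g → y * (a * b) * g ≡ a * (y * b * g)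
  regroup = solve-∀
  eq′ : ∀ x → (x - c) ^ e * F x ≡ (x - c) ^ e * H x
  eq′ x = trans (eq x) (trans (cong (λ z → (x - c) * z * G x) (ℤ.^-distribˡ-+-* (x - c) e k))
                              (regroup (x - c) ((x - c) ^ e) ((x - c) ^ k) (G x)))

factor-root-unique : ∀ c {e e′ F G} → IsPolynomial F → IsPolynomial G → F c ≢ 0ℤ → G c ≢ 0ℤ →
                     (∀ x → (x - c) ^ e * F x ≡ (x - c) ^ e′ * G x) → e ≡ e′ × F ≗ G
factor-root-unique c {e} {e′} {F} {G} pF pG Fc≢0 Gc≢0 eq with ℕ.<-cmp e e′
... | tri≈ _ refl _ = refl , power-cancel c e pF pG eq
... | tri< e<e′ _ _ with ℕ.m≤n⇒∃[o]m+o≡n e<e′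
...   | k , refl = contradiction (root-of-higher-power c e k pF pG eq) Fc≢0
factor-root-unique c {e} {e′} {F} {G} pF pG Fc≢0 Gc≢0 eq | tri> _ _ e′<e with ℕ.m≤n⇒∃[o]m+o≡n e′<e
...   | k , refl = contradiction (root-of-higher-power c e′ k pG pF (sym ∘ eq)) Gc≢0

+P-cancelʳ : ∀ P Q P′ Q′ → eval (P +P Q) ≗ eval (P′ +P Q′) → eval Q ≗ eval Q′ → eval P ≗ eval P′
+P-cancelʳ P Q P′ Q′ sum≗ Q≗ t = +-cancelʳ (eval Q t) (eval P t) (eval P′ t) (begin
  eval P t + eval Q t     ≡⟨ eval-+P P Q t ⟨
  eval (P +P Q) t         ≡⟨ sum≗ t ⟩
  eval (P′ +P Q′) t       ≡⟨ eval-+P P′ Q′ t ⟩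
  eval P′ t + eval Q′ t   ≡⟨ cong (λ q → eval P′ t + q) (Q≗ t) ⟨
  eval P′ t + eval Q t    ∎)

-P-cancelʳ : ∀ P Q P′ Q′ → eval (P -P Q) ≗ eval (P′ -P Q′) → eval Q ≗ eval Q′ → eval P ≗ eval P′
-P-cancelʳ P Q P′ Q′ diff≗ Q≗ t = +-cancelʳ (- eval Q t) (eval P t) (eval P′ t) (begin
  eval P t - eval Q t     ≡⟨ eval--P P Q t ⟨
  eval (P -P Q) t         ≡⟨ diff≗ t ⟩
  eval (P′ -P Q′) t       ≡⟨ eval--P P′ Q′ t ⟩
  eval P′ t - eval Q′ t   ≡⟨ cong (λ q → eval P′ t - q) (Q≗ t) ⟨
  eval P′ t - eval Q t    ∎)

X*P-cancel : ∀ P P′ → eval (X *P P) ≗ eval (X *P P′) → eval P ≗ eval P′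
X*P-cancel P P′ eq =
  polynomial-agree {g = awayFrom 0ℤ} (eval-isPolynomial P) (eval-isPolynomial P′) (awayFrom-unbounded 0ℤ) λ n →
        let x = awayFrom 0ℤ n in
        ℤ.*-cancelˡ-≡ x (eval P x) (eval P′ x) (trans (sym (eval-X*P P x)) (trans (eq x) (eval-X*P P′ x)))

-- Determinants by expansion along the first row

Matrix : ℕ → Set
Matrix n = Fin n → Fin n → ℤ

altSumℤ : ∀ {n} → (Fin n → ℤ) → ℤ
altSumℤ {zero}  f = 0ℤ
altSumℤ {suc n} f = f zero - altSumℤ (f ∘ suc)

minor : ∀ {A : Set} {n} → (Fin (suc n) → Fin (suc n) → A) → Fin (suc n) → Fin n → Fin n → A
minor M j r l = M (suc r) (punchIn j l)

detℤ : ∀ n → Matrix n → ℤ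
detℤ zero    M = 1ℤ
detℤ (suc n) M = altSumℤ (λ j → M zero j * detℤ n (minor M j))

altSumℤ-cong : ∀ {n} {f g : Fin n → ℤ} → (∀ j → f j ≡ g j) → altSumℤ f ≡ altSumℤ g
altSumℤ-cong {zero}  f≗g = refl
altSumℤ-cong {suc n} f≗g = cong₂ _-_ (f≗g zero) (altSumℤ-cong (f≗g ∘ suc))

altSumℤ-zero : ∀ {n} (f : Fin n → ℤ) → (∀ j → f j ≡ 0ℤ) → altSumℤ f ≡ 0ℤ
altSumℤ-zero {zero}  f f≗0 = refl
altSumℤ-zero {suc n} f f≗0 rewrite f≗0 zero | altSumℤ-zero (f ∘ suc) (f≗0 ∘ suc) = refl

altSumℤ-* : ∀ {n} c (f : Fin n → ℤ) → altSumℤ (λ j → c * f j) ≡ c * altSumℤ f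
altSumℤ-* {zero}  c f = sym (ℤ.*-zeroʳ c)
altSumℤ-* {suc n} c f rewrite altSumℤ-* c (f ∘ suc) = distrib c (f zero) _
  where
  distrib : ∀ c a b → c * a - c * b ≡ c * (a - b)
  distrib = solve-∀

altSumℤ-neg : ∀ {n} (f : Fin n → ℤ) → altSumℤ (λ j → - f j) ≡ - altSumℤ f
altSumℤ-neg {zero}  f = refl
altSumℤ-neg {suc n} f rewrite altSumℤ-neg (f ∘ suc) = sym (ℤ.neg-distrib-+ (f zero) _)

altSumℤ-- : ∀ {n} (f g : Fin n → ℤ) → altSumℤ (λ j → f j - g j) ≡ altSumℤ f - altSumℤ g
altSumℤ-- {zero}  f g = refl
altSumℤ-- {suc n} f g rewrite altSumℤ-- (f ∘ suc) (g ∘ suc) = interchange (f zero) (g zero) _ _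
  where
  interchange : ∀ a b c d → a - b - (c - d) ≡ a - c - (b - d)
  interchange = solve-∀

detℤ-cong : ∀ n {M N : Matrix n} → (∀ i j → M i j ≡ N i j) → detℤ n M ≡ detℤ n N
detℤ-cong zero    M≗N = refl
detℤ-cong (suc n) M≗N =
  altSumℤ-cong λ j → cong₂ _*_ (M≗N zero j) (detℤ-cong n (λ r l → M≗N (suc r) (punchIn j l)))

eval-altSum : ∀ {n} (f : Fin n → Poly) x → eval (altSum f) x ≡ altSumℤ (λ j → eval (f j) x)
eval-altSum {zero}  f x = refl
eval-altSum {suc n} f x
  rewrite eval--P (f zero) (altSum (f ∘ suc)) x | eval-altSum (f ∘ suc) x = refl

eval-det : ∀ n (M : Fin n → Fin n → Poly) x → eval (det n M) x ≡ detℤ n (λ i j → eval (M i j) x)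
eval-det zero    M x = eval-constP 1ℤ x
eval-det (suc n) M x = trans (eval-altSum (λ j → M zero j *P det n (minor M j)) x) (altSumℤ-cong λ j →
  trans (eval-*P (M zero j) (det n (minor M j)) x) (cong (eval (M zero j) x *_) (eval-det n (minor M j) x)))

scaleCol₀ : ∀ {n} → ℤ → Matrix (suc n) → Matrix (suc n)
scaleCol₀ c K r zero    = c * K r zero
scaleCol₀ c K r (suc l) = K r (suc l)

detℤ-scaleCol₀ : ∀ n c K → detℤ (suc n) (scaleCol₀ c K) ≡ c * detℤ (suc n) K
detℤ-scaleCol₀ zero    c K = assoc c (K zero zero)
  where
  assoc : ∀ c a → c * a * 1ℤ - 0ℤ ≡ c * (a * 1ℤ - 0ℤ)
  assoc = solve-∀
detℤ-scaleCol₀ (suc n) c K = begin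
  c * K zero zero * D₀ - rest (scaleCol₀ c K)  ≡⟨ cong (λ z → c * K zero zero * D₀ - z) rest-scaled ⟩
  c * K zero zero * D₀ - c * rest K            ≡⟨ factor-out c (K zero zero) D₀ (rest K) ⟩
  c * detℤ (suc (suc n)) K                     ∎
  where
  D₀ = detℤ (suc n) (minor K zero)
  rest : Matrix (suc (suc n)) → ℤ
  rest L = altSumℤ (λ j → L zero (suc j) * detℤ (suc n) (minor L (suc j)))
  factor-out : ∀ c a d s → c * a * d - c * s ≡ c * (a * d - s)
  factor-out = solve-∀
  swap-factors : ∀ a c d → a * (c * d) ≡ c * (a * d)
  swap-factors = solve-∀
  minor-scaled : ∀ j → detℤ (suc n) (minor (scaleCol₀ c K) (suc j)) ≡ c * detℤ (suc n) (minor K (suc j))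
  minor-scaled j =
    trans (detℤ-cong (suc n) {minor (scaleCol₀ c K) (suc j)} {scaleCol₀ c (minor K (suc j))}
                     λ { r zero → refl ; r (suc l) → refl })
          (detℤ-scaleCol₀ n c (minor K (suc j)))
  rest-scaled : rest (scaleCol₀ c K) ≡ c * rest K
  rest-scaled = trans
    (altSumℤ-cong λ j → trans (cong (K zero (suc j) *_) (minor-scaled j))
                              (swap-factors (K zero (suc j)) c (detℤ (suc n) (minor K (suc j)))))
    (altSumℤ-* c (λ j → K zero (suc j) * detℤ (suc n) (minor K (suc j))))

mutual
  detℤ-proportional-cols₀₁ : ∀ n e (K : Matrix (suc (suc n))) →
                             (∀ r → K r (suc zero) ≡ e * K r zero) → detℤ (suc (suc n)) K ≡ 0ℤ
  detℤ-proportional-cols₀₁ n e K col₁≡e*col₀ = begin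
    K₀₀ * D₀ - (K₀₁ * D₁ - rest)       ≡⟨ cong₂ (λ u v → K₀₀ * u - (K₀₁ * D₁ - v)) D₀≡e*D₁ rest≡0 ⟩
    K₀₀ * (e * D₁) - (K₀₁ * D₁ - 0ℤ)    ≡⟨ cong (λ z → K₀₀ * (e * D₁) - (z * D₁ - 0ℤ)) (col₁≡e*col₀ zero) ⟩
    K₀₀ * (e * D₁) - (e * K₀₀ * D₁ - 0ℤ) ≡⟨ cancel K₀₀ e D₁ ⟩
    0ℤ                                   ∎
    where
    K₀₀ = K zero zero
    K₀₁ = K zero (suc zero)
    D₀ = detℤ (suc n) (minor K zero)
    D₁ = detℤ (suc n) (minor K (suc zero))
    rest = altSumℤ (λ k → K zero (suc (suc k)) * detℤ (suc n) (minor K (suc (suc k))))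
    D₀≡e*D₁ : D₀ ≡ e * D₁
    D₀≡e*D₁ = trans (detℤ-cong (suc n) {minor K zero} {scaleCol₀ e (minor K (suc zero))}
                                 λ { r zero → col₁≡e*col₀ (suc r) ; r (suc l) → refl })
                    (detℤ-scaleCol₀ n e (minor K (suc zero)))
    rest≡0 : rest ≡ 0ℤ
    rest≡0 = altSumℤ-zero (λ k → K zero (suc (suc k)) * detℤ (suc n) (minor K (suc (suc k)))) λ k →
      trans (cong (K zero (suc (suc k)) *_) (minors-proportional-cols₀₁ n e K (col₁≡e*col₀ ∘ suc) k))
            (ℤ.*-zeroʳ (K zero (suc (suc k))))
    cancel : ∀ a e d → a * (e * d) - (e * a * d - 0ℤ) ≡ 0ℤ
    cancel = solve-∀

  minors-proportional-cols₀₁ : ∀ n e (K : Matrix (suc (suc n))) →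
                               (∀ r → K (suc r) (suc zero) ≡ e * K (suc r) zero) →
                               ∀ k → detℤ (suc n) (minor K (suc (suc k))) ≡ 0ℤ
  minors-proportional-cols₀₁ (suc n) e K col₁≡e*col₀ k =
    detℤ-proportional-cols₀₁ n e (minor K (suc (suc k))) col₁≡e*col₀

bordered : ∀ {n} → ℤ → ℤ → Matrix n → Matrix (suc n)
bordered c e N zero    zero    = c
bordered c e N zero    (suc l) = e
bordered c e N (suc r) zero    = e
bordered c e N (suc r) (suc l) = N r l

-- Expanding along the first column, detℤ (onesColumnFor N j) is the alternating sum of the
-- cofactors of N in column j; hence cofactorSum N is the sum of all cofactors, 1ᵀ adj(N) 1.
onesColumnFor : ∀ {n} → Matrix (suc n) → Fin (suc n) → Matrix (suc n)
onesColumnFor N j r zero    = 1ℤ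
onesColumnFor N j r (suc l) = N r (punchIn j l)

cofactorSum : ∀ n → Matrix n → ℤ
cofactorSum zero    N = 0ℤ
cofactorSum (suc n) N = altSumℤ (λ j → detℤ (suc n) (onesColumnFor N j))

cofactorSum-cong : ∀ n {M N : Matrix n} → (∀ i j → M i j ≡ N i j) → cofactorSum n M ≡ cofactorSum n N
cofactorSum-cong zero    M≗N = refl
cofactorSum-cong (suc n) {M} {N} M≗N = altSumℤ-cong λ j →
  detℤ-cong (suc n) {onesColumnFor M j} {onesColumnFor N j}
            λ { r zero → refl ; r (suc l) → M≗N r (punchIn j l) }

detℤ-minor-bordered : ∀ n c e (N : Matrix (suc n)) j →
                      detℤ (suc n) (minor (bordered c e N) (suc j)) ≡ e * detℤ (suc n) (onesColumnFor N j)
detℤ-minor-bordered n c e N j =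
  trans (detℤ-cong (suc n) {minor (bordered c e N) (suc j)} {scaleCol₀ e (onesColumnFor N j)}
                   λ { r zero → sym (ℤ.*-identityʳ e) ; r (suc l) → refl })
        (detℤ-scaleCol₀ n e (onesColumnFor N j))

detℤ-bordered : ∀ n c e (N : Matrix n) →
                detℤ (suc n) (bordered c e N) ≡ c * detℤ n N - e * e * cofactorSum n N
detℤ-bordered zero    c e N = cong (λ z → c * 1ℤ - z) (sym (ℤ.*-zeroʳ (e * e)))
detℤ-bordered (suc n) c e N = cong (λ z → c * detℤ (suc n) N - z) (begin
  altSumℤ (λ j → e * detℤ (suc n) (minor (bordered c e N) (suc j)))
    ≡⟨ altSumℤ-cong (λ j → cong (e *_) (detℤ-minor-bordered n c e N j)) ⟩
  altSumℤ (λ j → e * (e * Dⱼ j))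
    ≡⟨ altSumℤ-* e (λ j → e * Dⱼ j) ⟩
  e * altSumℤ (λ j → e * Dⱼ j)
    ≡⟨ cong (e *_) (altSumℤ-* e Dⱼ) ⟩
  e * (e * cofactorSum (suc n) N)
    ≡⟨ ℤ.*-assoc e e _ ⟨
  e * e * cofactorSum (suc n) N ∎)
  where
  Dⱼ : Fin (suc n) → ℤ
  Dⱼ j = detℤ (suc n) (onesColumnFor N j)

cofactorSum-bordered : ∀ n c e (N : Matrix n) →
                       cofactorSum (suc n) (bordered c e N) ≡ detℤ n N + (c - e - e) * cofactorSum n N
cofactorSum-bordered zero    c e N = cong (λ z → 1ℤ + z) (sym (ℤ.*-zeroʳ (c - e - e)))
cofactorSum-bordered (suc n) c e N = begin
  detℤ (suc (suc n)) (onesColumnFor B zero) - altSumℤ (λ j → detℤ (suc (suc n)) (onesColumnFor B (suc j)))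
    ≡⟨ cong₂ _-_ first-column (trans (altSumℤ-cong other-column) (altSumℤ-* (e - c) Dⱼ)) ⟩
  (1ℤ * D - e * S) - (e - c) * S
    ≡⟨ regroup D c e S ⟩
  D + (c - e - e) * S ∎
  where
  B = bordered c e N
  D = detℤ (suc n) N
  S = cofactorSum (suc n) N
  Dⱼ : Fin (suc n) → ℤ
  Dⱼ j = detℤ (suc n) (onesColumnFor N j)
  regroup : ∀ d c e s → 1ℤ * d - e * s - (e - c) * s ≡ d + (c - e - e) * s
  regroup = solve-∀
  first-column : detℤ (suc (suc n)) (onesColumnFor B zero) ≡ 1ℤ * D - e * S
  first-column = cong (λ z → 1ℤ * D - z) (trans
    (altSumℤ-cong λ j → cong (e *_) (detℤ-cong (suc n) {minor (onesColumnFor B zero) (suc j)} {onesColumnFor N j}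
                                       λ { r zero → refl ; r (suc l) → refl }))
    (altSumℤ-* e Dⱼ))
  other-column : ∀ j → detℤ (suc (suc n)) (onesColumnFor B (suc j)) ≡ (e - c) * Dⱼ j
  other-column j = begin
    1ℤ * detℤ (suc n) (minor K zero) - (c * D₁ - rest)  ≡⟨ cong₂ (λ u v → 1ℤ * u - (c * D₁ - v))
                                                                 (detℤ-minor-bordered n c e N j) rest≡0 ⟩
    1ℤ * (e * Dⱼ j) - (c * D₁ - 0ℤ)                     ≡⟨ cong (λ z → 1ℤ * (e * Dⱼ j) - (c * z - 0ℤ)) D₁≡Dⱼ ⟩
    1ℤ * (e * Dⱼ j) - (c * Dⱼ j - 0ℤ)                   ≡⟨ collect e c (Dⱼ j) ⟩
    (e - c) * Dⱼ j                                      ∎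
    where
    K = onesColumnFor B (suc j)
    D₁ = detℤ (suc n) (minor K (suc zero))
    rest = altSumℤ (λ k → e * detℤ (suc n) (minor K (suc (suc k))))
    D₁≡Dⱼ : D₁ ≡ Dⱼ j
    D₁≡Dⱼ = detℤ-cong (suc n) {minor K (suc zero)} {onesColumnFor N j} λ { r zero → refl ; r (suc l) → refl }
    -- below the first row, column 1 of K is e times column 0, which is all ones
    rest≡0 : rest ≡ 0ℤ
    rest≡0 = altSumℤ-zero (λ k → e * detℤ (suc n) (minor K (suc (suc k)))) λ k →
      trans (cong (e *_) (minors-proportional-cols₀₁ n e K (λ r → sym (ℤ.*-identityʳ e)) k)) (ℤ.*-zeroʳ e)
    collect : ∀ e c d → 1ℤ * (e * d) - (c * d - 0ℤ) ≡ (e - c) * d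
    collect = solve-∀

-- Invariance of the determinant under relabelling

swapAdj : ∀ {n} → Fin n → Fin (suc n) → Fin (suc n)
swapAdj zero    zero          = suc zero
swapAdj zero    (suc zero)    = zero
swapAdj zero    (suc (suc k)) = suc (suc k)
swapAdj (suc i) zero          = zero
swapAdj (suc i) (suc k)       = suc (swapAdj i k)

swapAdj-involutive : ∀ {n} (i : Fin n) → swapAdj i ∘ swapAdj i ≗ id
swapAdj-involutive zero    zero          = refl
swapAdj-involutive zero    (suc zero)    = refl
swapAdj-involutive zero    (suc (suc k)) = refl
swapAdj-involutive (suc i) zero          = refl
swapAdj-involutive (suc i) (suc k)       = cong suc (swapAdj-involutive i k)

-- Swapping columns i, i+1 of M and deleting column j leaves the minor of M at swapAdj i j, up to
-- a swap of two adjacent columns when j is not one of i, i+1; swapSign i j records which case occurs.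
swapSign : ∀ {n} → Fin n → Fin (suc n) → ℤ
swapSign zero    zero          = 1ℤ
swapSign zero    (suc zero)    = 1ℤ
swapSign zero    (suc (suc _)) = -1ℤ
swapSign (suc i) zero          = -1ℤ
swapSign (suc i) (suc j)       = swapSign i j

data SwapMinor {m} (i : Fin (suc m)) (j : Fin (suc (suc m))) : Set where
  swap-absorbed : swapSign i j ≡ 1ℤ →
                  (∀ l → swapAdj i (punchIn j l) ≡ punchIn (swapAdj i j) l) → SwapMinor i j
  swap-survives : swapSign i j ≡ -1ℤ → ∀ k →
                  (∀ l → swapAdj i (punchIn j l) ≡ punchIn (swapAdj i j) (swapAdj k l)) → SwapMinor i j

swapMinor : ∀ {m} (i : Fin (suc m)) j → SwapMinor i j
swapMinor zero zero             = swap-absorbed refl λ { zero → refl ; (suc l) → refl }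
swapMinor zero (suc zero)       = swap-absorbed refl λ { zero → refl ; (suc l) → refl }
swapMinor {suc m} zero (suc (suc j)) =
  swap-survives refl zero λ { zero → refl ; (suc zero) → refl ; (suc (suc l)) → refl }
swapMinor {suc m} (suc i) zero  = swap-survives refl i λ l → refl
swapMinor {suc m} (suc i) (suc j) with swapMinor i j
... | swap-absorbed sign≡1 commute =
  swap-absorbed sign≡1 λ { zero → refl ; (suc l) → cong suc (commute l) }
... | swap-survives sign≡-1 k commute =
  swap-survives sign≡-1 (suc k) λ { zero → refl ; (suc l) → cong suc (commute l) }

altSumℤ-swapAdj : ∀ {n} (i : Fin n) (h : Fin (suc n) → ℤ) →
                  altSumℤ (λ j → swapSign i j * h (swapAdj i j)) ≡ - altSumℤ h
altSumℤ-swapAdj {suc n} zero h = begin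
  1ℤ * h (suc zero) - (1ℤ * h zero - altSumℤ (λ k → -1ℤ * h (suc (suc k))))
    ≡⟨ cong (λ z → 1ℤ * h (suc zero) - (1ℤ * h zero - z))
            (trans (altSumℤ-cong (λ k → ℤ.-1*i≡-i (h (suc (suc k))))) (altSumℤ-neg (λ k → h (suc (suc k))))) ⟩
  1ℤ * h (suc zero) - (1ℤ * h zero - - altSumℤ (λ k → h (suc (suc k))))
    ≡⟨ swap-first-two (h zero) (h (suc zero)) (altSumℤ (λ k → h (suc (suc k)))) ⟩
  - altSumℤ h ∎
  where
  swap-first-two : ∀ a b c → 1ℤ * b - (1ℤ * a - - c) ≡ - (a - (b - c))
  swap-first-two = solve-∀
altSumℤ-swapAdj {suc n} (suc i) h = begin
  -1ℤ * h zero - altSumℤ (λ j → swapSign i j * h (suc (swapAdj i j)))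
    ≡⟨ cong (λ z → -1ℤ * h zero - z) (altSumℤ-swapAdj i (λ j → h (suc j))) ⟩
  -1ℤ * h zero - - altSumℤ (λ j → h (suc j))
    ≡⟨ negate (h zero) (altSumℤ (λ j → h (suc j))) ⟩
  - altSumℤ h ∎
  where
  negate : ∀ a c → -1ℤ * a - - c ≡ - (a - c)
  negate = solve-∀

detℤ-swapCols : ∀ n (i : Fin n) M → detℤ (suc n) (λ r c → M r (swapAdj i c)) ≡ - detℤ (suc n) M
detℤ-swapCols (suc m) i M = trans (altSumℤ-cong term) (altSumℤ-swapAdj i expansion)
  where
  expansion : Fin (suc (suc m)) → ℤ
  expansion c = M zero c * detℤ (suc m) (minor M c)
  term : ∀ j → M zero (swapAdj i j) * detℤ (suc m) (minor (λ r c → M r (swapAdj i c)) j)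
             ≡ swapSign i j * expansion (swapAdj i j)
  term j with swapMinor i j
  ... | swap-absorbed sign≡1 commute rewrite sign≡1 = begin
    M zero (swapAdj i j) * detℤ (suc m) (minor (λ r c → M r (swapAdj i c)) j)
      ≡⟨ cong (M zero (swapAdj i j) *_) (detℤ-cong (suc m) λ r l → cong (M (suc r)) (commute l)) ⟩
    expansion (swapAdj i j)
      ≡⟨ ℤ.*-identityˡ (expansion (swapAdj i j)) ⟨
    1ℤ * expansion (swapAdj i j) ∎
  ... | swap-survives sign≡-1 k commute rewrite sign≡-1 = begin
    M zero (swapAdj i j) * detℤ (suc m) (minor (λ r c → M r (swapAdj i c)) j)
      ≡⟨ cong (M zero (swapAdj i j) *_)
              (trans (detℤ-cong (suc m) {N = λ r l → minor M (swapAdj i j) r (swapAdj k l)}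
                                λ r l → cong (M (suc r)) (commute l))
                     (detℤ-swapCols m k (minor M (swapAdj i j)))) ⟩
    M zero (swapAdj i j) * - detℤ (suc m) (minor M (swapAdj i j))
      ≡⟨ ℤ.neg-distribʳ-* (M zero (swapAdj i j)) (detℤ (suc m) (minor M (swapAdj i j))) ⟨
    - expansion (swapAdj i j)
      ≡⟨ ℤ.-1*i≡-i (expansion (swapAdj i j)) ⟨
    -1ℤ * expansion (swapAdj i j) ∎

punchIn-punchIn-pinch : ∀ {m} (j : Fin (suc m)) (k : Fin m) → punchIn (punchIn j k) (pinch k j) ≡ j
punchIn-punchIn-pinch zero    zero    = refl
punchIn-punchIn-pinch zero    (suc k) = refl
punchIn-punchIn-pinch (suc j) zero    = refl
punchIn-punchIn-pinch (suc j) (suc k) = cong suc (punchIn-punchIn-pinch j k)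

punchIn-punchIn-exchange : ∀ {m} (j : Fin (suc (suc m))) (k : Fin (suc m)) (l : Fin m) →
                           punchIn (punchIn j k) (punchIn (pinch k j) l) ≡ punchIn j (punchIn k l)
punchIn-punchIn-exchange zero    zero    l       = refl
punchIn-punchIn-exchange zero    (suc k) l       = refl
punchIn-punchIn-exchange (suc j) zero    l       = refl
punchIn-punchIn-exchange (suc j) (suc k) zero    = refl
punchIn-punchIn-exchange (suc j) (suc k) (suc l) = cong suc (punchIn-punchIn-exchange j k l)

altSum² : ∀ {m} → (Fin (suc m) → Fin m → ℤ) → ℤ
altSum² F = altSumℤ (λ j → altSumℤ (F j))

-- (j , k) ↦ (punchIn j k , pinch k j) exchanges the two members of the pair of distinct
-- positions (j , punchIn j k), and this reverses the sign of the double alternating sum.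
altSum²-exchange : ∀ m (F : Fin (suc m) → Fin m → ℤ) →
                   altSum² F + altSum² (λ j k → F (punchIn j k) (pinch k j)) ≡ 0ℤ
altSum²-exchange zero    F = refl
altSum²-exchange (suc m) F = begin
  (A - altSumℤ (λ j → B j - altSumℤ (F′ j))) + (altSumℤ B - altSumℤ (λ j → F zero j - altSumℤ (F′* j)))
    ≡⟨ cong₂ (λ u v → (A - u) + (altSumℤ B - v))
             (altSumℤ-- B (λ j → altSumℤ (F′ j))) (altSumℤ-- (F zero) (λ j → altSumℤ (F′* j))) ⟩
  (A - (altSumℤ B - altSum² F′)) + (altSumℤ B - (A - altSum² F′*))
    ≡⟨ telescope A (altSumℤ B) (altSum² F′) (altSum² F′*) ⟩
  altSum² F′ + altSum² F′*
    ≡⟨ altSum²-exchange m F′ ⟩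
  0ℤ ∎
  where
  A = altSumℤ (F zero)
  B : Fin (suc m) → ℤ
  B j = F (suc j) zero
  F′ : Fin (suc m) → Fin m → ℤ
  F′ j k = F (suc j) (suc k)
  F′* : Fin (suc m) → Fin m → ℤ
  F′* j k = F′ (punchIn j k) (pinch k j)
  telescope : ∀ a b c d → (a - (b - c)) + (b - (a - d)) ≡ c + d
  telescope = solve-∀

detℤ-swapRows : ∀ n (i : Fin n) M → detℤ (suc n) (λ r c → M (swapAdj i r) c) ≡ - detℤ (suc n) M
detℤ-swapRows (suc m) (suc i) M = begin
  altSumℤ (λ j → M zero j * detℤ (suc m) (λ r c → minor M j (swapAdj i r) c))
    ≡⟨ altSumℤ-cong (λ j → trans (cong (M zero j *_) (detℤ-swapRows m i (minor M j)))
                                 (sym (ℤ.neg-distribʳ-* (M zero j) (detℤ (suc m) (minor M j))))) ⟩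
  altSumℤ (λ j → - (M zero j * detℤ (suc m) (minor M j)))
    ≡⟨ altSumℤ-neg (λ j → M zero j * detℤ (suc m) (minor M j)) ⟩
  - detℤ (suc (suc m)) M ∎
detℤ-swapRows (suc m) zero M = begin
  detℤ (suc (suc m)) (λ r c → M (swapAdj zero r) c)
    ≡⟨ altSumℤ-cong (λ j → trans (sym (altSumℤ-* (M (suc zero) j) (λ k → M zero (punchIn j k) * E j k)))
                                 (altSumℤ-cong (exchanged j))) ⟩
  altSum² (λ j k → F (punchIn j k) (pinch k j))
    ≡⟨ inverseʳ-unique (altSum² F) _ (altSum²-exchange (suc m) F) ⟩
  - altSum² F
    ≡⟨ cong -_ (altSumℤ-cong (λ j → altSumℤ-* (M zero j) (λ k → M (suc zero) (punchIn j k) * E j k))) ⟩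
  - detℤ (suc (suc m)) M ∎
  where
  E : Fin (suc (suc m)) → Fin (suc m) → ℤ
  E j k = detℤ m (λ r l → M (suc (suc r)) (punchIn j (punchIn k l)))
  F : Fin (suc (suc m)) → Fin (suc m) → ℤ
  F j k = M zero j * (M (suc zero) (punchIn j k) * E j k)
  swap-factors : ∀ a b e → a * (b * e) ≡ b * (a * e)
  swap-factors = solve-∀
  exchanged : ∀ j k → M (suc zero) j * (M zero (punchIn j k) * E j k) ≡ F (punchIn j k) (pinch k j)
  exchanged j k = trans (swap-factors (M (suc zero) j) (M zero (punchIn j k)) (E j k))
    (cong (M zero (punchIn j k) *_) (sym (cong₂ _*_ (cong (M (suc zero)) (punchIn-punchIn-pinch j k))
      (detℤ-cong m λ r l → cong (M (suc (suc r))) (punchIn-punchIn-exchange j k l)))))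

RelabelInvariant : ∀ n → (Fin n → Fin n) → Set
RelabelInvariant n f = ∀ (M : Matrix n) → detℤ n (λ r c → M (f r) (f c)) ≡ detℤ n M

swapAdj-relabelInvariant : ∀ n (i : Fin n) → RelabelInvariant (suc n) (swapAdj i)
swapAdj-relabelInvariant n i M = begin
  detℤ (suc n) (λ r c → M (swapAdj i r) (swapAdj i c)) ≡⟨ detℤ-swapRows n i (λ r c → M r (swapAdj i c)) ⟩
  - detℤ (suc n) (λ r c → M r (swapAdj i c))           ≡⟨ cong -_ (detℤ-swapCols n i M) ⟩
  - - detℤ (suc n) M                                   ≡⟨ ℤ.neg-involutive _ ⟩
  detℤ (suc n) M                                       ∎

applySwaps : ∀ {n} → List (Fin n) → Fin (suc n) → Fin (suc n)
applySwaps []       = id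
applySwaps (i ∷ is) = swapAdj i ∘ applySwaps is

applySwaps-relabelInvariant : ∀ {n} (is : List (Fin n)) → RelabelInvariant (suc n) (applySwaps is)
applySwaps-relabelInvariant []       M = refl
applySwaps-relabelInvariant {n} (i ∷ is) M =
  trans (applySwaps-relabelInvariant is (λ r c → M (swapAdj i r) (swapAdj i c))) (swapAdj-relabelInvariant n i M)

relabelInvariant-≗ : ∀ {n f g} → f ≗ g → RelabelInvariant n g → RelabelInvariant n f
relabelInvariant-≗ {n} f≗g g-invariant M = trans (detℤ-cong n λ r c → cong₂ M (f≗g r) (f≗g c)) (g-invariant M)

applySwaps-++ : ∀ {n} (is js : List (Fin n)) → applySwaps (is ++ js) ≗ applySwaps is ∘ applySwaps js
applySwaps-++ []       js x = refl
applySwaps-++ (i ∷ is) js x = cong (swapAdj i) (applySwaps-++ is js x)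

applySwaps-suc-zero : ∀ {n} (is : List (Fin n)) → applySwaps (map suc is) zero ≡ zero
applySwaps-suc-zero []       = refl
applySwaps-suc-zero (i ∷ is) = cong (swapAdj (suc i)) (applySwaps-suc-zero is)

applySwaps-suc : ∀ {n} (is : List (Fin n)) y → applySwaps (map suc is) (suc y) ≡ suc (applySwaps is y)
applySwaps-suc []       y = refl
applySwaps-suc (i ∷ is) y = cong (swapAdj (suc i)) (applySwaps-suc is y)

applySwaps-lift₀ : ∀ {n} (π : Permutation′ (suc n)) is →
                   (π ⟨$⟩ʳ_) ≗ applySwaps is → (lift₀ π ⟨$⟩ʳ_) ≗ applySwaps (map suc is)
applySwaps-lift₀ π is π≗is zero    = sym (applySwaps-suc-zero is)
applySwaps-lift₀ π is π≗is (suc y) = trans (cong suc (π≗is y)) (sym (applySwaps-suc is y))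

swapAdjₚ : ∀ {n} → Fin n → Permutation′ (suc n)
swapAdjₚ i = permutation (swapAdj i) (swapAdj i) (swapAdj-involutive i) (swapAdj-involutive i)

rotation : ∀ {n} → Fin (suc n) → Permutation′ (suc n)
rotation          zero    = Perm.id
rotation {suc n} (suc k) = swapAdjₚ zero ∘ₚ lift₀ (rotation k)

rotation-zero : ∀ {n} (k : Fin (suc n)) → rotation k ⟨$⟩ʳ zero ≡ k
rotation-zero          zero    = refl
rotation-zero {suc n} (suc k) = cong suc (rotation-zero k)

rotationSwaps : ∀ {n} → Fin (suc n) → List (Fin n)
rotationSwaps          zero    = []
rotationSwaps {suc n} (suc k) = zero ∷ map suc (rotationSwaps k)

rotation⁻¹-swaps : ∀ {n} (k : Fin (suc n)) → (rotation k ⟨$⟩ˡ_) ≗ applySwaps (rotationSwaps k)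
rotation⁻¹-swaps          zero    x = refl
rotation⁻¹-swaps {suc n} (suc k) zero    = cong (swapAdj zero) (sym (applySwaps-suc-zero (rotationSwaps k)))
rotation⁻¹-swaps {suc n} (suc k) (suc y) =
  cong (swapAdj zero) (trans (cong suc (rotation⁻¹-swaps k y)) (sym (applySwaps-suc (rotationSwaps k) y)))

-- Rotating π⁻¹(0) to the front reduces π to a permutation fixing 0, i.e. to one of size n.
permutation-swaps : ∀ n (π : Permutation′ (suc n)) → Σ (List (Fin n)) λ is → (π ⟨$⟩ʳ_) ≗ applySwaps is
permutation-swaps zero    π = [] , λ { zero → only-zero (π ⟨$⟩ʳ zero) }
  where
  only-zero : (x : Fin 1) → x ≡ zero
  only-zero zero = refl
permutation-swaps (suc n) π = map suc is ++ rotationSwaps k , λ x → begin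
  π ⟨$⟩ʳ x                                              ≡⟨ cong (π ⟨$⟩ʳ_) (inverseʳ (rotation k)) ⟨
  ρ ⟨$⟩ʳ (rotation k ⟨$⟩ˡ x)                            ≡⟨ lift₀-remove ρ ρ-fixes-zero (rotation k ⟨$⟩ˡ x) ⟨
  lift₀ (remove zero ρ) ⟨$⟩ʳ (rotation k ⟨$⟩ˡ x)        ≡⟨ applySwaps-lift₀ (remove zero ρ) is ρ′≗is _ ⟩
  applySwaps (map suc is) (rotation k ⟨$⟩ˡ x)           ≡⟨ cong (applySwaps (map suc is)) (rotation⁻¹-swaps k x) ⟩
  applySwaps (map suc is) (applySwaps (rotationSwaps k) x) ≡⟨ applySwaps-++ (map suc is) (rotationSwaps k) x ⟨
  applySwaps (map suc is ++ rotationSwaps k) x          ∎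
  where
  k = π ⟨$⟩ˡ zero
  ρ = rotation k ∘ₚ π
  ρ-fixes-zero : ρ ⟨$⟩ʳ zero ≡ zero
  ρ-fixes-zero = trans (cong (π ⟨$⟩ʳ_) (rotation-zero k)) (inverseʳ π)
  is : List (Fin n)
  is = proj₁ (permutation-swaps n (remove zero ρ))
  ρ′≗is : (remove zero ρ ⟨$⟩ʳ_) ≗ applySwaps is
  ρ′≗is = proj₂ (permutation-swaps n (remove zero ρ))

detℤ-relabel : ∀ {m n} (π : Permutation m n) (M : Matrix n) →
               detℤ m (λ r c → M (π ⟨$⟩ʳ r) (π ⟨$⟩ʳ c)) ≡ detℤ n M
detℤ-relabel π with ↔⇒≡ π
detℤ-relabel {zero}  π | refl = λ M → refl
detℤ-relabel {suc n} π | refl =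
  let is , π≗is = permutation-swaps n π in relabelInvariant-≗ π≗is (applySwaps-relabelInvariant is)

-- Characteristic polynomials of threshold graphs

≅-sym : ∀ {G H} → G ≅ H → H ≅ G
≅-sym {G} {H} (π , π-adj) = Perm.flip π , λ i j →
  sym (trans (π-adj (π ⟨$⟩ˡ i) (π ⟨$⟩ˡ j)) (cong₂ (adj H) (inverseʳ π) (inverseʳ π)))

≅-trans : ∀ {G H K} → G ≅ H → H ≅ K → G ≅ K
≅-trans (π , π-adj) (ρ , ρ-adj) = π ∘ₚ ρ , λ i j → trans (π-adj i j) (ρ-adj (π ⟨$⟩ʳ i) (π ⟨$⟩ʳ j))

charMatrix : (G : Graph) → ℤ → Matrix (order G)
charMatrix G x i j = (if does (i ≟ j) then x else 0ℤ) - adjMatrix G i j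

charDet : Graph → ℤ → ℤ
charDet G x = detℤ (order G) (charMatrix G x)

eval-charPoly : ∀ G x → eval (charPoly G) x ≡ charDet G x
eval-charPoly G x = trans (eval-det (order G) _ x) (detℤ-cong (order G) entry)
  where
  entry : ∀ i j → eval ((if does (i ≟ j) then X else []) -P constP (adjMatrix G i j)) x ≡ charMatrix G x i j
  entry i j with does (i ≟ j) | adjMatrix G i j
  ... | true  | a = trans (eval--P X (constP a) x) (cong₂ _-_ (eval-X x) (eval-constP a x))
  ... | false | a = trans (eval--P [] (constP a) x) (cong (λ z → 0ℤ - z) (eval-constP a x))

charDet-≅ : ∀ {G H} → G ≅ H → charDet G ≗ charDet H
charDet-≅ {G} {H} (π , π-adj) x = trans (detℤ-cong (order G) entry) (detℤ-relabel π (charMatrix H x))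
  where
  entry : ∀ i j → charMatrix G x i j ≡ charMatrix H x (π ⟨$⟩ʳ i) (π ⟨$⟩ʳ j)
  entry i j = cong₂ (λ d a → (if d then x else 0ℤ) - boolℤ a)
                    (does-⇔ i≡j⇔πi≡πj (i ≟ j) (π ⟨$⟩ʳ i ≟ π ⟨$⟩ʳ j)) (π-adj i j)
    where
    i≡j⇔πi≡πj = mk⇔ (cong (π ⟨$⟩ʳ_)) (Injection.injective (↔⇒↣ π))

charMatrix-addVertex : ∀ b G x i j → charMatrix (addVertex b G) x i j ≡ bordered x (- boolℤ b) (charMatrix G x) i j
charMatrix-addVertex b G x zero    zero    = ℤ.+-identityʳ x
charMatrix-addVertex b G x zero    (suc j) = ℤ.+-identityˡ (- boolℤ b)
charMatrix-addVertex b G x (suc i) zero    = ℤ.+-identityˡ (- boolℤ b)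
charMatrix-addVertex b G x (suc i) (suc j) = refl

vertexStep : Bool → ℤ → ℤ × ℤ → ℤ × ℤ
vertexStep false x (p , r) = x * p , x * r + p
vertexStep true  x (p , r) = (x + 1ℤ) * p - r , (x + 1ℤ) * r

charPair : List Bool → ℤ → ℤ × ℤ
charPair []      x = x , x + 1ℤ
charPair (b ∷ s) x = vertexStep b x (charPair s x)

detPair : Graph → ℤ → ℤ × ℤ
detPair G x = charDet G x , charDet G x + cofactorSum (order G) (charMatrix G x)

detPair-addVertex : ∀ b G x → detPair (addVertex b G) x ≡ vertexStep b x (detPair G x)
detPair-addVertex b G x = begin
  detPair (addVertex b G) x
    ≡⟨ cong₂ (λ d w → d , d + w)
         (trans (detℤ-cong (suc n) (charMatrix-addVertex b G x)) (detℤ-bordered n x (- boolℤ b) N))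
         (trans (cofactorSum-cong (suc n) (charMatrix-addVertex b G x))
                (cofactorSum-bordered n x (- boolℤ b) N)) ⟩
  borderedPair (- boolℤ b)
    ≡⟨ borderedPair-vertexStep b ⟩
  vertexStep b x (D , D + W) ∎
  where
  n = order G
  N = charMatrix G x
  D = detℤ n N
  W = cofactorSum n N
  borderedPair : ℤ → ℤ × ℤ
  borderedPair e = x * D - e * e * W , x * D - e * e * W + (D + (x - e - e) * W)
  isolated₁ : ∀ x d w → x * d - 0ℤ * 0ℤ * w ≡ x * d
  isolated₁ = solve-∀
  isolated₂ : ∀ x d w → x * d - 0ℤ * 0ℤ * w + (d + (x - 0ℤ - 0ℤ) * w) ≡ x * (d + w) + d
  isolated₂ = solve-∀
  dominating₁ : ∀ x d w → x * d - -1ℤ * -1ℤ * w ≡ (x + 1ℤ) * d - (d + w)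
  dominating₁ = solve-∀
  dominating₂ : ∀ x d w → x * d - -1ℤ * -1ℤ * w + (d + (x - -1ℤ - -1ℤ) * w) ≡ (x + 1ℤ) * (d + w)
  dominating₂ = solve-∀
  borderedPair-vertexStep : ∀ b → borderedPair (- boolℤ b) ≡ vertexStep b x (D , D + W)
  borderedPair-vertexStep false = cong₂ _,_ (isolated₁ x D W) (isolated₂ x D W)
  borderedPair-vertexStep true  = cong₂ _,_ (dominating₁ x D W) (dominating₂ x D W)

detPair-build : ∀ s x → detPair (build s) x ≡ charPair s x
detPair-build []      x = cong₂ _,_ (single-vertex x) (cong (λ d → d + 1ℤ) (single-vertex x))
  where
  single-vertex : ∀ x → (x - 0ℤ) * 1ℤ - 0ℤ ≡ x
  single-vertex = solve-∀
detPair-build (b ∷ s) x = trans (detPair-addVertex b (build s) x) (cong (vertexStep b x) (detPair-build s x))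

-- Recovering the construction sequence

pronic : ℤ → ℤ
pronic x = x * (x + 1ℤ)

-- covector false a c A B is the row vector x^a (x+1)^c (A(y) , x B(y)), and covector true a c A B
-- is x^a (x+1)^c ((x+1) A(y) , B(y)), where y = pronic x.
record Covector : Set where
  constructor covector
  field
    shape        : Bool
    mult₀ mult₋₁ : ℕ
    A B          : Poly
open Covector

pairCore : Covector → ℤ → ℤ × ℤ → ℤ
pairCore (covector false _ _ A B) x (p , r) = eval A (pronic x) * p + x * eval B (pronic x) * r
pairCore (covector true  _ _ A B) x (p , r) = (x + 1ℤ) * eval A (pronic x) * p + eval B (pronic x) * r

pair : Covector → ℤ → ℤ × ℤ → ℤ
pair w x v = x ^ mult₀ w * (x + 1ℤ) ^ mult₋₁ w * pairCore w x v

pullback : Bool → Covector → Covector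
pullback false (covector false a c A B) = covector false (suc a) c (A +P B) B
pullback true  (covector false a c A B) = covector true a c A ((X *P B) -P A)
pullback false (covector true  a c A B) = covector false a c ((X *P A) +P B) B
pullback true  (covector true  a c A B) = covector true a (suc c) A (B -P A)

pair-pullback : ∀ b w x v → pair (pullback b w) x v ≡ pair w x (vertexStep b x v)
pair-pullback false (covector false a c A B) x (p , r)
  rewrite eval-+P A B (pronic x) = regroup x (x ^ a) ((x + 1ℤ) ^ c) (eval A (pronic x)) (eval B (pronic x)) p r
  where
  regroup : ∀ x u v a b p r → x * u * v * ((a + b) * p + x * b * r) ≡ u * v * (a * (x * p) + x * b * (x * r + p))
  regroup = solve-∀
pair-pullback true (covector false a c A B) x (p , r)
  rewrite eval--P (X *P B) A (pronic x) | eval-X*P B (pronic x)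
  = regroup x (x ^ a) ((x + 1ℤ) ^ c) (eval A (pronic x)) (eval B (pronic x)) p r
  where
  regroup : ∀ x u v a b p r → u * v * ((x + 1ℤ) * a * p + (x * (x + 1ℤ) * b - a) * r)
                            ≡ u * v * (a * ((x + 1ℤ) * p - r) + x * b * ((x + 1ℤ) * r))
  regroup = solve-∀
pair-pullback false (covector true a c A B) x (p , r)
  rewrite eval-+P (X *P A) B (pronic x) | eval-X*P A (pronic x)
  = regroup x (x ^ a) ((x + 1ℤ) ^ c) (eval A (pronic x)) (eval B (pronic x)) p r
  where
  regroup : ∀ x u v a b p r → u * v * ((x * (x + 1ℤ) * a + b) * p + x * b * r)
                            ≡ u * v * ((x + 1ℤ) * a * (x * p) + b * (x * r + p))
  regroup = solve-∀
pair-pullback true (covector true a c A B) x (p , r)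
  rewrite eval--P B A (pronic x) = regroup x (x ^ a) ((x + 1ℤ) ^ c) (eval A (pronic x)) (eval B (pronic x)) p r
  where
  regroup : ∀ x u v a b p r → u * ((x + 1ℤ) * v) * ((x + 1ℤ) * a * p + (b - a) * r)
                            ≡ u * v * ((x + 1ℤ) * a * ((x + 1ℤ) * p - r) + b * ((x + 1ℤ) * r))
  regroup = solve-∀

initial : Covector
initial = covector false 0 0 (constP 1ℤ) []

pair-initial : ∀ x p r → pair initial x (p , r) ≡ p
pair-initial x p r = first-coordinate x (pronic x) p r
  where
  first-coordinate : ∀ x y p r → 1ℤ * 1ℤ * ((1ℤ + y * 0ℤ) * p + x * 0ℤ * r) ≡ p
  first-coordinate = solve-∀

pair-charPair : ∀ s w x → pair w x (charPair s x) ≡ pair (foldl (flip pullback) w s) x (x , x + 1ℤ)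
pair-charPair []      w x = refl
pair-charPair (b ∷ s) w x = trans (sym (pair-pullback b w x (charPair s x))) (pair-charPair s (pullback b w) x)

vertexStep-ones : ∀ b x → vertexStep b x (1ℤ , 1ℤ) ≡ (x , x + 1ℤ)
vertexStep-ones false x = cong₂ _,_ (ℤ.*-identityʳ x) (cong (_+ 1ℤ) (ℤ.*-identityʳ x))
vertexStep-ones true  x = cong₂ _,_ (drop-one x) (ℤ.*-identityʳ (x + 1ℤ))
  where
  drop-one : ∀ x → (x + 1ℤ) * 1ℤ - 1ℤ ≡ x
  drop-one = solve-∀

reduced : Covector → ℤ → ℤ
reduced w x = pairCore w x (1ℤ , 1ℤ)

pair-ones : ∀ w x → pair w x (1ℤ , 1ℤ) ≡ x ^ mult₀ w * ((x + 1ℤ) ^ mult₋₁ w * reduced w x)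
pair-ones w x = ℤ.*-assoc (x ^ mult₀ w) _ _

pronicCoeff₀ pronicCoeff₁ : Covector → ℤ → ℤ
pronicCoeff₀ (covector false _ _ A B) t = eval A t
pronicCoeff₀ (covector true  _ _ A B) t = eval A t + eval B t
pronicCoeff₁ (covector false _ _ A B) t = eval B t
pronicCoeff₁ (covector true  _ _ A B) t = eval A t

reduced-pronic : ∀ w x → reduced w x ≡ pronicCoeff₀ w (pronic x) + x * pronicCoeff₁ w (pronic x)
reduced-pronic (covector false _ _ A B) x = drop-ones x (eval A (pronic x)) (eval B (pronic x))
  where
  drop-ones : ∀ x a b → a * 1ℤ + x * b * 1ℤ ≡ a + x * b
  drop-ones = solve-∀
reduced-pronic (covector true  _ _ A B) x = regroup x (eval A (pronic x)) (eval B (pronic x))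
  where
  regroup : ∀ x a b → (x + 1ℤ) * a * 1ℤ + b * 1ℤ ≡ a + b + x * a
  regroup = solve-∀

pronicCoeff₀-isPolynomial : ∀ w → IsPolynomial (pronicCoeff₀ w)
pronicCoeff₀-isPolynomial (covector false _ _ A B) = eval-isPolynomial A
pronicCoeff₀-isPolynomial (covector true  _ _ A B) = +-isPolynomial (eval-isPolynomial A) (eval-isPolynomial B)

pronicCoeff₁-isPolynomial : ∀ w → IsPolynomial (pronicCoeff₁ w)
pronicCoeff₁-isPolynomial (covector false _ _ A B) = eval-isPolynomial B
pronicCoeff₁-isPolynomial (covector true  _ _ A B) = eval-isPolynomial A

pronic-isPolynomial : IsPolynomial pronic
pronic-isPolynomial = *-isPolynomial id-isPolynomial (+-isPolynomial id-isPolynomial (const-isPolynomial 1ℤ))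

reduced-isPolynomial : ∀ w → IsPolynomial (reduced w)
reduced-isPolynomial w = ≗-isPolynomial (reduced-pronic w) (+-isPolynomial
  (∘-isPolynomial (pronicCoeff₀-isPolynomial w) pronic-isPolynomial)
  (*-isPolynomial id-isPolynomial (∘-isPolynomial (pronicCoeff₁-isPolynomial w) pronic-isPolynomial)))

pronic-unbounded : Unbounded (pronic ∘ +[1+_])
pronic-unbounded n = ℕ.≤-trans (ℕ.n<1+n n) (ℕ.m≤m*n (suc n) (suc n ℕ.+ 1))

pronic-reflect : ∀ x → pronic (-1ℤ - x) ≡ pronic x
pronic-reflect = expanded
  where
  expanded : ∀ x → (-1ℤ - x) * ((-1ℤ - x) + 1ℤ) ≡ x * (x + 1ℤ)
  expanded = solve-∀

-- x and -1-x have the same pronic value, so the two parts are separated by evaluating at both.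
pronic-decomposition-unique : ∀ {U V U′ V′} →
                              IsPolynomial U → IsPolynomial V → IsPolynomial U′ → IsPolynomial V′ →
                              (∀ x → U (pronic x) + x * V (pronic x) ≡ U′ (pronic x) + x * V′ (pronic x)) →
                              U ≗ U′ × V ≗ V′
pronic-decomposition-unique {U} {V} {U′} {V′} pU pV pU′ pV′ eq =
  polynomial-agree pU pU′ pronic-unbounded U-agree , polynomial-agree pV pV′ pronic-unbounded V-agree
  where
  reflected : ∀ x → U (pronic x) + (-1ℤ - x) * V (pronic x) ≡ U′ (pronic x) + (-1ℤ - x) * V′ (pronic x)
  reflected x = subst (λ y → U y + (-1ℤ - x) * V y ≡ U′ y + (-1ℤ - x) * V′ y) (pronic-reflect x) (eq (-1ℤ - x))
  difference : ∀ x u v u′ v′ → (x + x + 1ℤ) * (v - v′)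
                              ≡ (u + x * v - (u′ + x * v′)) - (u + (-1ℤ - x) * v - (u′ + (-1ℤ - x) * v′))
  difference = solve-∀
  V-agree : ∀ n → V (pronic +[1+ n ]) ≡ V′ (pronic +[1+ n ])
  V-agree n = cancel (ℤ.i*j≡0⇒i≡0∨j≡0 (x + x + 1ℤ) product≡0)
    where
    x = +[1+ n ]
    y = pronic x
    product≡0 : (x + x + 1ℤ) * (V y - V′ y) ≡ 0ℤ
    product≡0 = begin
      (x + x + 1ℤ) * (V y - V′ y)
        ≡⟨ difference x (U y) (V y) (U′ y) (V′ y) ⟩
      (U y + x * V y - (U′ y + x * V′ y)) - (U y + (-1ℤ - x) * V y - (U′ y + (-1ℤ - x) * V′ y))
        ≡⟨ cong₂ _-_ (ℤ.i≡j⇒i-j≡0 (eq x)) (ℤ.i≡j⇒i-j≡0 (reflected x)) ⟩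
      0ℤ ∎
    cancel : x + x + 1ℤ ≡ 0ℤ ⊎ V y - V′ y ≡ 0ℤ → V y ≡ V′ y
    cancel (inj₁ ())
    cancel (inj₂ V-V′≡0) = ℤ.i-j≡0⇒i≡j (V y) (V′ y) V-V′≡0
  U-agree : ∀ n → U (pronic +[1+ n ]) ≡ U′ (pronic +[1+ n ])
  U-agree n = +-cancelʳ (+[1+ n ] * V′ (pronic +[1+ n ])) _ _
    (trans (cong (λ v → U (pronic +[1+ n ]) + +[1+ n ] * v) (sym (V-agree n))) (eq +[1+ n ]))

at0 : Covector → ℤ × ℤ
at0 w = eval (A w) 0ℤ , eval (B w) 0ℤ

pullback₀ : Bool → Bool → ℤ × ℤ → ℤ × ℤ
pullback₀ false false (α , β) = α + β , β
pullback₀ true  false (α , β) = α , - α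
pullback₀ false true  (α , β) = β , β
pullback₀ true  true  (α , β) = α , β - α

at0-pullback : ∀ b w → at0 (pullback b w) ≡ pullback₀ b (shape w) (at0 w)
at0-pullback false (covector false a c A B) = cong (_, eval B 0ℤ) (eval-+P A B 0ℤ)
at0-pullback true  (covector false a c A B) = cong (eval A 0ℤ ,_) (begin
  eval ((X *P B) -P A) 0ℤ       ≡⟨ eval--P (X *P B) A 0ℤ ⟩
  eval (X *P B) 0ℤ - eval A 0ℤ  ≡⟨ cong (_- eval A 0ℤ) (eval-X*P B 0ℤ) ⟩
  0ℤ * eval B 0ℤ - eval A 0ℤ    ≡⟨ cong (_- eval A 0ℤ) (ℤ.*-zeroˡ (eval B 0ℤ)) ⟩
  0ℤ - eval A 0ℤ                ≡⟨ ℤ.+-identityˡ (- eval A 0ℤ) ⟩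
  - eval A 0ℤ                   ∎)
at0-pullback false (covector true  a c A B) = cong (_, eval B 0ℤ) (begin
  eval ((X *P A) +P B) 0ℤ       ≡⟨ eval-+P (X *P A) B 0ℤ ⟩
  eval (X *P A) 0ℤ + eval B 0ℤ  ≡⟨ cong (_+ eval B 0ℤ) (eval-X*P A 0ℤ) ⟩
  0ℤ * eval A 0ℤ + eval B 0ℤ    ≡⟨ cong (_+ eval B 0ℤ) (ℤ.*-zeroˡ (eval A 0ℤ)) ⟩
  0ℤ + eval B 0ℤ                ≡⟨ ℤ.+-identityˡ (eval B 0ℤ) ⟩
  eval B 0ℤ                     ∎)
at0-pullback true  (covector true  a c A B) = cong (eval A 0ℤ ,_) (eval--P B A 0ℤ)

-- (α , β) are the values of (A , B) at 0. Along pullbacks from initial the ratio m + k is at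
-- least 1; the closing step raises it to 2, which keeps 0 and -1 from being roots of the
-- reduced polynomial.
Admissible : ℕ → Bool → ℤ × ℤ → Set
Admissible m false (α , β) = (α ≡ 1ℤ × β ≡ 0ℤ) ⊎ (β ≢ 0ℤ × Σ ℕ λ k → α ≡ + (m ℕ.+ k) * β)
Admissible m true  (α , β) = α ≢ 0ℤ × Σ ℕ λ k → β ≡ - (+ (m ℕ.+ k) * α)

Valid : ℕ → Covector → Set
Valid m w = Admissible m (shape w) (at0 w)

*-≢0 : ∀ {a b} → a ≢ 0ℤ → b ≢ 0ℤ → a * b ≢ 0ℤ
*-≢0 {a} a≢0 b≢0 ab≡0 with ℤ.i*j≡0⇒i≡0∨j≡0 a ab≡0
... | inj₁ a≡0 = a≢0 a≡0
... | inj₂ b≡0 = b≢0 b≡0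

suc-*-≢0 : ∀ k {a} → a ≢ 0ℤ → +[1+ k ] * a ≢ 0ℤ
suc-*-≢0 k = *-≢0 {+[1+ k ]} λ ()

neg-≢0 : ∀ {a} → a ≢ 0ℤ → - a ≢ 0ℤ
neg-≢0 a≢0 -a≡0 = a≢0 (ℤ.neg-injective -a≡0)

admissible-false-α≢0 : ∀ {m} v → Admissible (suc m) false v → proj₁ v ≢ 0ℤ
admissible-false-α≢0 v (inj₁ (α≡1 , _)) α≡0 = contradiction (trans (sym α≡1) α≡0) λ ()
admissible-false-α≢0 {m} v (inj₂ (β≢0 , k , α≡)) α≡0 = suc-*-≢0 (m ℕ.+ k) β≢0 (trans (sym α≡) α≡0)

admissible-true-β≢0 : ∀ {m} v → Admissible (suc m) true v → proj₂ v ≢ 0ℤ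
admissible-true-β≢0 {m} v (α≢0 , k , β≡) β≡0 = neg-≢0 (suc-*-≢0 (m ℕ.+ k) α≢0) (trans (sym β≡) β≡0)

+[1+]-*-step : ∀ k b → +[1+ k ] * b + b ≡ +[1+ suc k ] * b
+[1+]-*-step k b = add-one +[1+ k ] b
  where
  add-one : ∀ K b → K * b + b ≡ (1ℤ + K) * b
  add-one = solve-∀

-[1+]-*-step : ∀ k a → - (+[1+ k ] * a) - a ≡ - (+[1+ suc k ] * a)
-[1+]-*-step k a = subtract-one +[1+ k ] a
  where
  subtract-one : ∀ K a → - (K * a) - a ≡ - ((1ℤ + K) * a)
  subtract-one = solve-∀

admissible-pullback : ∀ b s v → Admissible 1 s v → Admissible 1 b (pullback₀ b s v)
admissible-pullback false false (α , β) (inj₁ (α≡1 , β≡0)) = inj₁ (cong₂ _+_ α≡1 β≡0 , β≡0)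
admissible-pullback false false (α , β) (inj₂ (β≢0 , k , α≡)) =
  inj₂ (β≢0 , suc k , trans (cong (_+ β) α≡) (+[1+]-*-step k β))
admissible-pullback true  false (α , β) adm =
  admissible-false-α≢0 {0} (α , β) adm , 0 , sym (cong -_ (ℤ.*-identityˡ α))
admissible-pullback false true  (α , β) adm =
  inj₂ (admissible-true-β≢0 {0} (α , β) adm , 0 , sym (ℤ.*-identityˡ β))
admissible-pullback true  true  (α , β) (α≢0 , k , β≡) =
  α≢0 , suc k , trans (cong (_- α) β≡) (-[1+]-*-step k α)

admissible-close : ∀ s v → Admissible 1 s v → Admissible 2 s (pullback₀ s s v)
admissible-close false (α , β) (inj₁ (α≡1 , β≡0)) = inj₁ (cong₂ _+_ α≡1 β≡0 , β≡0)
admissible-close false (α , β) (inj₂ (β≢0 , k , α≡)) =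
  inj₂ (β≢0 , k , trans (cong (_+ β) α≡) (+[1+]-*-step k β))
admissible-close true  (α , β) (α≢0 , k , β≡) =
  α≢0 , k , trans (cong (_- α) β≡) (-[1+]-*-step k α)

reduced₀ reduced₋₁ : Bool → ℤ × ℤ → ℤ
reduced₀ false (α , β) = α
reduced₀ true  (α , β) = α + β
reduced₋₁ false (α , β) = α - β
reduced₋₁ true  (α , β) = β

reduced-at-0 : ∀ w → reduced w 0ℤ ≡ reduced₀ (shape w) (at0 w)
reduced-at-0 (covector false _ _ A B) = at-zero (eval A 0ℤ) (eval B 0ℤ)
  where
  at-zero : ∀ a b → a * 1ℤ + 0ℤ * b * 1ℤ ≡ a
  at-zero = solve-∀
reduced-at-0 (covector true  _ _ A B) = at-zero (eval A 0ℤ) (eval B 0ℤ)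
  where
  at-zero : ∀ a b → (0ℤ + 1ℤ) * a * 1ℤ + b * 1ℤ ≡ a + b
  at-zero = solve-∀

reduced-at-−1 : ∀ w → reduced w -1ℤ ≡ reduced₋₁ (shape w) (at0 w)
reduced-at-−1 (covector false _ _ A B) = at-minus-one (eval A 0ℤ) (eval B 0ℤ)
  where
  at-minus-one : ∀ a b → a * 1ℤ + -1ℤ * b * 1ℤ ≡ a - b
  at-minus-one = solve-∀
reduced-at-−1 (covector true  _ _ A B) = at-minus-one (eval A 0ℤ) (eval B 0ℤ)
  where
  at-minus-one : ∀ a b → (-1ℤ + 1ℤ) * a * 1ℤ + b * 1ℤ ≡ b
  at-minus-one = solve-∀

admissible-reduced₀-≢0 : ∀ s v → Admissible 2 s v → reduced₀ s v ≢ 0ℤ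
admissible-reduced₀-≢0 false v adm = admissible-false-α≢0 {1} v adm
admissible-reduced₀-≢0 true (α , β) (α≢0 , k , β≡) α+β≡0 =
  neg-≢0 (suc-*-≢0 k α≢0) (trans (sym (collect (+[1+ k ]) α)) (trans (cong (λ b → α + b) (sym β≡)) α+β≡0))
  where
  collect : ∀ K a → a + - ((1ℤ + K) * a) ≡ - (K * a)
  collect = solve-∀

admissible-reduced₋₁-≢0 : ∀ s v → Admissible 2 s v → reduced₋₁ s v ≢ 0ℤ
admissible-reduced₋₁-≢0 false (α , β) (inj₁ (α≡1 , β≡0)) α-β≡0 =
  contradiction (trans (sym (cong₂ _-_ α≡1 β≡0)) α-β≡0) λ ()
admissible-reduced₋₁-≢0 false (α , β) (inj₂ (β≢0 , k , α≡)) α-β≡0 =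
  suc-*-≢0 k β≢0 (trans (sym (collect (+[1+ k ]) β)) (trans (cong (_- β) (sym α≡)) α-β≡0))
  where
  collect : ∀ K b → (1ℤ + K) * b - b ≡ K * b
  collect = solve-∀
admissible-reduced₋₁-≢0 true v adm = admissible-true-β≢0 {1} v adm

admissible-shapes-disjoint : ∀ α β → Admissible 2 false (α + β , α) → Admissible 2 true (α , β) → ⊥
admissible-shapes-disjoint α β (inj₁ (_ , α≡0)) (α≢0 , _) = α≢0 α≡0
admissible-shapes-disjoint α β (inj₂ (_ , k₁ , α+β≡)) (α≢0 , k , β≡) =
  suc-*-≢0 (k₁ ℕ.+ suc (suc k)) α≢0 (begin
    (K′ + K - 1ℤ) * α          ≡⟨ expand K′ K α ⟩
    K′ * α - (α + - (K * α))  ≡⟨ cong₂ (λ u v → u - (α + v)) (sym α+β≡) (sym β≡) ⟩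
    (α + β) - (α + β)         ≡⟨ ℤ.+-inverseʳ (α + β) ⟩
    0ℤ                        ∎)
  where
  K′ = +[1+ suc k₁ ]
  K  = +[1+ suc k ]
  expand : ∀ K′ K a → (K′ + K - 1ℤ) * a ≡ K′ * a - (a + - (K * a))
  expand = solve-∀

pullback₀-shape-injective : ∀ b {s s′ v v′} → Admissible 1 s v → Admissible 1 s′ v′ →
                            pullback₀ b s v ≡ pullback₀ b s′ v′ → s ≡ s′
pullback₀-shape-injective b     {false} {false} _ _ _ = refl
pullback₀-shape-injective b     {true}  {true}  _ _ _ = refl
pullback₀-shape-injective false {false} {true} {α , β} {α′ , β′} adm _ eq =
  contradiction α≡0 (admissible-false-α≢0 {0} (α , β) adm)
  where
  α≡0 : α ≡ 0ℤ
  α≡0 = +-cancelʳ β α 0ℤ (begin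
    α + β   ≡⟨ cong proj₁ eq ⟩
    β′      ≡⟨ cong proj₂ eq ⟨
    β       ≡⟨ ℤ.+-identityˡ β ⟨
    0ℤ + β  ∎)
pullback₀-shape-injective false {true} {false} adm adm′ eq =
  sym (pullback₀-shape-injective false adm′ adm (sym eq))
pullback₀-shape-injective true {false} {true} {α , β} {α′ , β′} _ adm′ eq =
  contradiction β′≡0 (admissible-true-β≢0 {0} (α′ , β′) adm′)
  where
  β′≡0 : β′ ≡ 0ℤ
  β′≡0 = +-cancelʳ (- α′) β′ 0ℤ (begin
    β′ - α′     ≡⟨ cong proj₂ eq ⟨
    - α         ≡⟨ cong -_ (cong proj₁ eq) ⟩
    - α′        ≡⟨ ℤ.+-identityˡ (- α′) ⟨
    0ℤ + - α′   ∎)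
pullback₀-shape-injective true {true} {false} adm adm′ eq =
  sym (pullback₀-shape-injective true adm′ adm (sym eq))

record _≈_ (v w : Covector) : Set where
  constructor mk≈
  field
    shape≡  : shape v ≡ shape w
    mult₀≡  : mult₀ v ≡ mult₀ w
    mult₋₁≡ : mult₋₁ v ≡ mult₋₁ w
    A≗      : eval (A v) ≗ eval (A w)
    B≗      : eval (B v) ≗ eval (B w)

≈-sym : ∀ {v w} → v ≈ w → w ≈ v
≈-sym (mk≈ s≡ a≡ c≡ A≗ B≗) = mk≈ (sym s≡) (sym a≡) (sym c≡) (sym ∘ A≗) (sym ∘ B≗)

≈-at0 : ∀ {v w} → v ≈ w → at0 v ≡ at0 w
≈-at0 (mk≈ _ _ _ A≗ B≗) = cong₂ _,_ (A≗ 0ℤ) (B≗ 0ℤ)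

shape-pullback : ∀ b w → shape (pullback b w) ≡ b
shape-pullback false (covector false _ _ _ _) = refl
shape-pullback true  (covector false _ _ _ _) = refl
shape-pullback false (covector true  _ _ _ _) = refl
shape-pullback true  (covector true  _ _ _ _) = refl

valid-pullback : ∀ b w → Valid 1 w → Valid 1 (pullback b w)
valid-pullback b w valid = subst₂ (Admissible 1) (sym (shape-pullback b w)) (sym (at0-pullback b w))
                                  (admissible-pullback b (shape w) (at0 w) valid)

closing : Covector → Covector
closing w = pullback (shape w) w

valid-closing : ∀ w → Valid 1 w → Valid 2 (closing w)
valid-closing w valid = subst₂ (Admissible 2) (sym (shape-pullback (shape w) w)) (sym (at0-pullback (shape w) w))
                               (admissible-close (shape w) (at0 w) valid)

pullback-injective-sameShape : ∀ b s {a c A B a′ c′ A′ B′} →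
                               pullback b (covector s a c A B) ≈ pullback b (covector s a′ c′ A′ B′) →
                               covector s a c A B ≈ covector s a′ c′ A′ B′
pullback-injective-sameShape false false {A = A} {B} {A′ = A′} {B′} (mk≈ _ a≡ c≡ A≗ B≗) =
  mk≈ refl (ℕ.suc-injective a≡) c≡ (+P-cancelʳ A B A′ B′ A≗ B≗) B≗
pullback-injective-sameShape true false {A = A} {B} {A′ = A′} {B′} (mk≈ _ a≡ c≡ A≗ B≗) =
  mk≈ refl a≡ c≡ A≗ (X*P-cancel B B′ (-P-cancelʳ (X *P B) A (X *P B′) A′ B≗ A≗))
pullback-injective-sameShape false true {A = A} {B} {A′ = A′} {B′} (mk≈ _ a≡ c≡ A≗ B≗) =
  mk≈ refl a≡ c≡ (X*P-cancel A A′ (+P-cancelʳ (X *P A) B (X *P A′) B′ A≗ B≗)) B≗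
pullback-injective-sameShape true true {A = A} {B} {A′ = A′} {B′} (mk≈ _ a≡ c≡ A≗ B≗) =
  mk≈ refl a≡ (ℕ.suc-injective c≡) A≗ (-P-cancelʳ B A B′ A′ B≗ A≗)

pullback-injective : ∀ b v w → Valid 1 v → Valid 1 w → pullback b v ≈ pullback b w → v ≈ w
pullback-injective b v@(covector s _ _ _ _) w@(covector s′ _ _ _ _) valid-v valid-w eq
  with pullback₀-shape-injective b {s} {s′} valid-v valid-w
         (trans (sym (at0-pullback b v)) (trans (≈-at0 eq) (at0-pullback b w)))
... | refl = pullback-injective-sameShape b s eq

initial-≉-pullback : ∀ b w → ¬ (initial ≈ pullback b w)
initial-≉-pullback true  w eq = contradiction (trans (_≈_.shape≡ eq) (shape-pullback true w)) λ ()
initial-≉-pullback false (covector false _ _ _ _) (mk≈ _ () _ _ _)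
initial-≉-pullback false w@(covector true _ _ _ _) eq =
  contradiction (trans (cong proj₁ values) (sym (cong proj₂ values))) λ ()
  where
  values = trans (≈-at0 eq) (at0-pullback false w)

covectorOf : List Bool → Covector
covectorOf = foldr pullback initial

valid-covectorOf : ∀ r → Valid 1 (covectorOf r)
valid-covectorOf []      = inj₁ (refl , refl)
valid-covectorOf (b ∷ r) = valid-pullback b (covectorOf r) (valid-covectorOf r)

covectorOf-injective : ∀ r r′ → covectorOf r ≈ covectorOf r′ → r ≡ r′
covectorOf-injective []      []        eq = refl
covectorOf-injective []      (b ∷ r′)  eq = ⊥-elim (initial-≉-pullback b (covectorOf r′) eq)
covectorOf-injective (b ∷ r) []        eq = ⊥-elim (initial-≉-pullback b (covectorOf r) (≈-sym eq))
covectorOf-injective (b ∷ r) (b′ ∷ r′) eq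
  with trans (sym (shape-pullback b (covectorOf r))) (trans (_≈_.shape≡ eq) (shape-pullback b′ (covectorOf r′)))
... | refl = cong (b ∷_) (covectorOf-injective r r′
               (pullback-injective b (covectorOf r) (covectorOf r′) (valid-covectorOf r) (valid-covectorOf r′) eq))

pronicCoeffs-injective : ∀ v w → Valid 2 v → Valid 2 w →
                         pronicCoeff₀ v ≗ pronicCoeff₀ w → pronicCoeff₁ v ≗ pronicCoeff₁ w →
                         shape v ≡ shape w × eval (A v) ≗ eval (A w) × eval (B v) ≗ eval (B w)
pronicCoeffs-injective (covector false _ _ _ _) (covector false _ _ _ _) _ _ U≗ V≗ = refl , U≗ , V≗
pronicCoeffs-injective (covector true _ _ A B) (covector true _ _ A′ B′) _ _ U≗ V≗ =
  refl , V≗ , λ t → +-cancelˡ (eval A t) (eval B t) (eval B′ t) (trans (U≗ t) (cong (_+ eval B′ t) (sym (V≗ t))))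
pronicCoeffs-injective (covector false _ _ _ _) (covector true _ _ A′ B′) valid-v valid-w U≗ V≗ =
  ⊥-elim (admissible-shapes-disjoint (eval A′ 0ℤ) (eval B′ 0ℤ)
            (subst (Admissible 2 false) (cong₂ _,_ (U≗ 0ℤ) (V≗ 0ℤ)) valid-v) valid-w)
pronicCoeffs-injective (covector true _ _ A B) (covector false _ _ _ _) valid-v valid-w U≗ V≗ =
  ⊥-elim (admissible-shapes-disjoint (eval A 0ℤ) (eval B 0ℤ)
            (subst (Admissible 2 false) (cong₂ _,_ (sym (U≗ 0ℤ)) (sym (V≗ 0ℤ))) valid-w) valid-v)

reduced-injective : ∀ v w → Valid 2 v → Valid 2 w → mult₀ v ≡ mult₀ w → mult₋₁ v ≡ mult₋₁ w →
                    reduced v ≗ reduced w → v ≈ w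
reduced-injective v w valid-v valid-w a≡ c≡ eq =
  let U≗ , V≗ = pronic-decomposition-unique (pronicCoeff₀-isPolynomial v) (pronicCoeff₁-isPolynomial v)
                                            (pronicCoeff₀-isPolynomial w) (pronicCoeff₁-isPolynomial w)
                  λ x → trans (sym (reduced-pronic v x)) (trans (eq x) (reduced-pronic w x))
      s≡ , A≗ , B≗ = pronicCoeffs-injective v w valid-v valid-w U≗ V≗
  in mk≈ s≡ a≡ c≡ A≗ B≗

reduced-at-0-≢0 : ∀ u → Valid 2 u → reduced u 0ℤ ≢ 0ℤ
reduced-at-0-≢0 u valid rewrite reduced-at-0 u = admissible-reduced₀-≢0 (shape u) (at0 u) valid

reduced-at-−1-≢0 : ∀ u → Valid 2 u → reduced u -1ℤ ≢ 0ℤ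
reduced-at-−1-≢0 u valid rewrite reduced-at-−1 u = admissible-reduced₋₁-≢0 (shape u) (at0 u) valid

closing-injective : ∀ v w → Valid 2 v → Valid 2 w → (∀ x → pair v x (1ℤ , 1ℤ) ≡ pair w x (1ℤ , 1ℤ)) → v ≈ w
closing-injective v w valid-v valid-w eq = reduced-injective v w valid-v valid-w mult₀≡ mult₋₁≡ reduced≗
  where
  residue₀ : Covector → ℤ → ℤ
  residue₀ u x = (x + 1ℤ) ^ mult₋₁ u * reduced u x
  residue₀-isPolynomial : ∀ u → IsPolynomial (residue₀ u)
  residue₀-isPolynomial u =
    *-isPolynomial (^-isPolynomial (+-isPolynomial id-isPolynomial (const-isPolynomial 1ℤ)) (mult₋₁ u))
                   (reduced-isPolynomial u)
  residue₀-at-0-≢0 : ∀ u → Valid 2 u → residue₀ u 0ℤ ≢ 0ℤ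
  residue₀-at-0-≢0 u valid rewrite ℤ.^-zeroˡ (mult₋₁ u) | ℤ.*-identityˡ (reduced u 0ℤ) = reduced-at-0-≢0 u valid
  factored-at-0 : ∀ x → (x - 0ℤ) ^ mult₀ v * residue₀ v x ≡ (x - 0ℤ) ^ mult₀ w * residue₀ w x
  factored-at-0 x = subst (λ y → y ^ mult₀ v * residue₀ v x ≡ y ^ mult₀ w * residue₀ w x) (sym (ℤ.+-identityʳ x))
                          (trans (sym (pair-ones v x)) (trans (eq x) (pair-ones w x)))
  root-0 = factor-root-unique 0ℤ (residue₀-isPolynomial v) (residue₀-isPolynomial w)
                              (residue₀-at-0-≢0 v valid-v) (residue₀-at-0-≢0 w valid-w) factored-at-0
  mult₀≡ = proj₁ root-0
  root-−1 = factor-root-unique -1ℤ (reduced-isPolynomial v) (reduced-isPolynomial w)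
                               (reduced-at-−1-≢0 v valid-v) (reduced-at-−1-≢0 w valid-w) (proj₂ root-0)
  mult₋₁≡ = proj₁ root-−1
  reduced≗ = proj₂ root-−1

pair-closing : ∀ w x → pair w x (x , x + 1ℤ) ≡ pair (closing w) x (1ℤ , 1ℤ)
pair-closing w x = trans (cong (pair w x) (sym (vertexStep-ones (shape w) x)))
                         (sym (pair-pullback (shape w) w x (1ℤ , 1ℤ)))

charDet-closing : ∀ s x → charDet (build s) x ≡ pair (closing (covectorOf (reverse s))) x (1ℤ , 1ℤ)
charDet-closing s x = begin
  charDet (build s) x
    ≡⟨ cong proj₁ (detPair-build s x) ⟩
  proj₁ (charPair s x)
    ≡⟨ pair-initial x _ _ ⟨
  pair initial x (charPair s x)
    ≡⟨ pair-charPair s initial x ⟩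
  pair (foldl (flip pullback) initial s) x (x , x + 1ℤ)
    ≡⟨ cong (λ w → pair w x (x , x + 1ℤ)) (List.foldr-ʳ++ pullback initial s) ⟨
  pair (covectorOf (reverse s)) x (x , x + 1ℤ)
    ≡⟨ pair-closing (covectorOf (reverse s)) x ⟩
  pair (closing (covectorOf (reverse s))) x (1ℤ , 1ℤ) ∎

charDet-build-injective : ∀ s t → charDet (build s) ≗ charDet (build t) → s ≡ t
charDet-build-injective s t eq = List.reverse-injective (List.∷-injectiveʳ (covectorOf-injective r r′ closings≈))
  where
  r  = shape (covectorOf (reverse s)) ∷ reverse s
  r′ = shape (covectorOf (reverse t)) ∷ reverse t
  -- covectorOf r is closing (covectorOf (reverse s)) by definition
  closings≈ : covectorOf r ≈ covectorOf r′
  closings≈ = closing-injective (covectorOf r) (covectorOf r′)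
    (valid-closing _ (valid-covectorOf (reverse s))) (valid-closing _ (valid-covectorOf (reverse t)))
    λ x → trans (sym (charDet-closing s x)) (trans (eq x) (charDet-closing t x))

sameSpectrum-charDet : ∀ {G H} → SameSpectrum G H → charDet G ≗ charDet H
sameSpectrum-charDet {G} {H} same x = begin
  charDet G x          ≡⟨ eval-charPoly G x ⟨
  eval (charPoly G) x  ≡⟨ eval-cong-coeff (charPoly G) (charPoly H) same x ⟩
  eval (charPoly H) x  ≡⟨ eval-charPoly H x ⟩
  charDet H x          ∎

theorem6 : (G H : Graph) → IsThreshold G → IsThreshold H → SameSpectrum G H → G ≅ H
theorem6 G H (s , G≅s) (t , H≅t) same =
  ≅-trans {G} {build s} {H} G≅s (subst (λ u → build u ≅ H) (sym s≡t) (≅-sym {H} {build t} H≅t))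
  where
  s≡t : s ≡ t
  s≡t = charDet-build-injective s t λ x → begin
    charDet (build s) x  ≡⟨ charDet-≅ {G} {build s} G≅s x ⟨
    charDet G x          ≡⟨ sameSpectrum-charDet {G} {H} same x ⟩
    charDet H x          ≡⟨ charDet-≅ {H} {build t} H≅t x ⟩
    charDet (build t) x  ∎
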